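{- Let $S$ be a set of variables of $R_{\mathbf{a}}$ and let $Z_S=S\cap\{z_1,\ldots,z_n\}=\{z_{i_1},\ldots,z_{i_k}\}$ with $i_1<\cdots<i_k$ (set $i_{k+1}=i_1$). Then $S$ is a facet of $\mathcal{T}_{\mathbf{a}}$ if and only if $Z_S\neq\emptyset$ and, for every $1\le t\le k$, the sequence of multi-edges traversed clockwise from $i_t$ to $i_{t+1}$ (namely the multi-edges with indices $i_t,i_t+1,\ldots,i_{t+1}-1$ mod $n$; all $n$ multi-edges if $k=1$) is of one of the following two forms: (1) the first multi-edge is of type A, it is followed by zero or more multi-edges each of type A or type B, then by exactly one multi-edge of type C in which every edge contributes either its $\overleftarrow{y}$-variable or its $t$-variable, and all remaining (zero or more) multi-edges are of type B; (2) the first multi-edge is of type C in which every edge contributes either its $z$-variable (the edge variable $z^{(i)}_j$) or its $t$-variable, and all remaining (zero or more) multi-edges are of type B.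
   Context: Fix $n\ge3$ and $\mathbf{a}=(a_1,\ldots,a_n)$ with $a_i\ge1$. $C_{\mathbf{a}}$ is the graph on $[n]$ (indices mod $n$) whose edges are, for each $i$, the $a_i$ parallel edges $e^{(i)}_1,\ldots,e^{(i)}_{a_i}$ between $i$ and $i+1$ (the $i$-th multi-edge). Let $R_{\mathbf{a}}$ be the polynomial ring over a field in variables $z_k$ ($k\in[n]$) and, for each edge $e=e^{(i)}_j$, $z^{(i)}_j,t^{(i)}_j,\overrightarrow{y}^{(i)}_j,\overleftarrow{y}^{(i)}_j$, corresponding to lattice points $\mathbf{e}_k,\mathbf{e}_e,\mathbf{e}_i+\mathbf{e}_{i+1}-\mathbf{e}_e,\mathbf{e}_i-\mathbf{e}_{i+1}+\mathbf{e}_e,-\mathbf{e}_i+\mathbf{e}_{i+1}+\mathbf{e}_e$ in $\mathbb{R}^{[n]\cup E}$. Put $V(e^{(i)}_j)=\{\overrightarrow{y}^{(i)}_j,\overleftarrow{y}^{(i)}_j,t^{(i)}_j,z^{(i)}_j\}$; an edge $e$ "contributes" the variables in $S\cap V(e)$. Let $<$ be the lexicographic order induced by $\overrightarrow{y}^{(1)}_1>\cdots>\overrightarrow{y}^{(1)}_{a_1}>\overrightarrow{y}^{(2)}_1>\cdots>\overrightarrow{y}^{(n)}_{a_n}>\overleftarrow{y}^{(n)}_{a_n}>\cdots>\overleftarrow{y}^{(n)}_1>\overleftarrow{y}^{(n-1)}_{a_{n-1}}>\cdots>\overleftarrow{y}^{(1)}_1>z^{(1)}_1>\cdots>z^{(n)}_{a_n}>t^{(1)}_1>\cdots>t^{(n)}_{a_n}>z_1>\cdots>z_n$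 (within each block, upper index first, then lower index, in the directions shown). For an edge directed $a\to b$ write $y(a\to b)$ for its $y$-variable corresponding to $\mathbf{e}_a-\mathbf{e}_b+\mathbf{e}_e$. Let $B$ consist of: fundamental binomials for each edge $e$ between $i,i+1$: $\overrightarrow{y}\,\overleftarrow{y}-z_e^2$, $\overrightarrow{y}t-z_i^2$, $\overleftarrow{y}t-z_{i+1}^2$, $\overrightarrow{y}z_{i+1}-z_iz_e$, $\overleftarrow{y}z_i-z_{i+1}z_e$, $tz_e-z_iz_{i+1}$; zig-zag binomials $z_v\prod_{f\in E_1}y(f)\prod_{f\in E_2}z_f-z_u\prod_{f\in E_2}y(f)\prod_{f\in E_1}z_f$ for every path from $u$ to $v$ of length $\ge2$ and partition of its edges into $P_1\ni$ (edge at $u$), $P_2\ni$ (edge at $v$), $E_1$ = $P_1$ directed towards $v$, $E_2$ = $P_2$ directed towards $u$; cyclic binomials $\prod_{f\in E_1}y(f)\prod_{f\in E_2}z_f-\prod_{f\in E_2}y(f)\prod_{f\in E_1}z_f$ for every cycle with fixed orientation and partition $C_1\cup C_2$ of its edges (one part possibly empty), $E_1$ = $C_1$ directed along, $E_2$ = $C_2$ directed against the orientation. A facet of $\mathcal{T}_{\mathbf{a}}$ is a set $S$ of $n+a_1+\cdots+a_n$ variables containing (i.e. including all variables of) the $<$-leading monomial of no binomial in $B$. For a set $S$ of variables and $i\in[n]$, the $i$-th multi-edge is of type A if there is $j$ with $S\cap V(e^{(i)}_j)=\{\overrightarrow{y}^{(i)}_j,z^{(i)}_j\}$ and each other edge $e^{(i)}_k$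 contributes exactly one variable, lying in $\{t^{(i)}_k,z^{(i)}_k\}$ if $k<j$ and in $\{t^{(i)}_k,\overrightarrow{y}^{(i)}_k\}$ if $k>j$; it is of type B if there is $j$ with $S\cap V(e^{(i)}_j)=\{\overleftarrow{y}^{(i)}_j,z^{(i)}_j\}$ and each other edge contributes exactly one variable, lying in $\{t^{(i)}_k,\overleftarrow{y}^{(i)}_k\}$ if $k<j$ and in $\{t^{(i)}_k,z^{(i)}_k\}$ if $k>j$; it is of type C if every edge $e^{(i)}_j$ contributes exactly one variable. -}

module Defs where

open import Data.Nat using (ℕ; zero; suc; _+_; _*_; _∸_; _≤_; _<_; _<?_)
open import Data.Fin as Fin using (Fin; toℕ; fromℕ<)
open import Data.List using (List; allFin; []; _∷_; _++_; map; concatMap; length; filterᵇ; upTo)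
open import Data.List.Relation.Unary.All using (All)
open import Data.List.Relation.Unary.Unique.Propositional using (Unique)
open import Data.Product using (Σ; _×_; _,_; proj₁; proj₂; ∃)
open import Data.Sum using (_⊎_)
open import Data.Bool using (Bool; true; false; if_then_else_)
open import Data.Unit using (⊤)
open import Data.Empty using (⊥)
open import Relation.Nullary using (¬_; yes; no)
open import Relation.Binary.PropositionalEquality using (_≡_)
open import Function using (_∘_)

-- Cyclic arithmetic on the vertex set [n] = Fin n (vertex 1 ↦ Fin 0, …)

sucMod : ∀ {n} → Fin n → Fin n
sucMod {suc m} i with suc (toℕ i) <? suc m
... | yes p = fromℕ< p
... | no _ = Fin.zero

shift : ∀ {n} → Fin n → ℕ → Fin n
shift i zero = i
shift i (suc m) = sucMod (shift i m)

-- edge e^{(i)}_j  (multi-edge i joins vertex i and vertex i+1 mod n)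
Edge : (n : ℕ) → (Fin n → ℕ) → Set
Edge n a = Σ (Fin n) (λ i → Fin (a i))

data Var (n : ℕ) (a : Fin n → ℕ) : Set where
  zv : Fin n → Var n a
  ze : Edge n a → Var n a
  tv : Edge n a → Var n a
  yf : Edge n a → Var n a       -- →y^{(i)}_j   (y(i → i+1))
  yb : Edge n a → Var n a       -- ←y^{(i)}_j   (y(i+1 → i))

total : ∀ {n} → (Fin n → ℕ) → ℕ
total {zero} a = 0
total {suc n} a = a Fin.zero + total (a ∘ Fin.suc)

before : ∀ {n} → (Fin n → ℕ) → Fin n → ℕ
before a Fin.zero = 0
before a (Fin.suc i) = a Fin.zero + before (a ∘ Fin.suc) i

pos : ∀ {n} {a : Fin n → ℕ} → Edge n a → ℕ
pos {a = a} (i , j) = before a i + toℕ j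

-- rank in the variable order: rank 0 is the largest variable
rank : ∀ {n} {a : Fin n → ℕ} → Var n a → ℕ
rank {a = a} (yf e) = pos e
rank {a = a} (yb e) = total a + (total a ∸ suc (pos e))
rank {a = a} (ze e) = 2 * total a + pos e
rank {a = a} (tv e) = 3 * total a + pos e
rank {a = a} (zv k) = 4 * total a + toℕ k

Monomial : (n : ℕ) → (Fin n → ℕ) → Set
Monomial n a = List (Var n a)

_==ℕ_ : ℕ → ℕ → Bool
zero ==ℕ zero = true
zero ==ℕ suc _ = false
suc _ ==ℕ zero = false
suc m ==ℕ suc k = m ==ℕ k

-- exponent of v in m (variables identified via their (injective) rank)
deg : ∀ {n} {a : Fin n → ℕ} → Monomial n a → Var n a → ℕ
deg m v = length (filterᵇ (λ x → rank x ==ℕ rank v) m)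

-- m₂ <lex m₁ : m₁ is larger in the lexicographic order induced by rank
_<lex_ : ∀ {n} {a : Fin n → ℕ} → Monomial n a → Monomial n a → Set
_<lex_ {n} {a} m₂ m₁ = Σ (Var n a) λ v → (deg m₂ v < deg m₁ v) ×
  (∀ w → rank w < rank v → deg m₁ w ≡ deg m₂ w)

data Dir : Set where
  fwd bwd : Dir

Step : (n : ℕ) → (Fin n → ℕ) → Set
Step n a = Edge n a × Dir

module _ {n : ℕ} {a : Fin n → ℕ} where

  edgeOf : Step n a → Edge n a
  edgeOf = proj₁

  tailS headS : Step n a → Fin n
  tailS ((i , _) , fwd) = i
  tailS ((i , _) , bwd) = sucMod i
  headS ((i , _) , fwd) = sucMod i
  headS ((i , _) , bwd) = i

  revS : Step n a → Step n a
  revS (e , fwd) = (e , bwd)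
  revS (e , bwd) = (e , fwd)

  yOf : Step n a → Var n a
  yOf (e , fwd) = yf e
  yOf (e , bwd) = yb e

  Chain : List (Step n a) → Set
  Chain [] = ⊤
  Chain (s ∷ []) = ⊤
  Chain (s ∷ s' ∷ ss) = (headS s ≡ tailS s') × Chain (s' ∷ ss)

  vertices : Step n a → List (Step n a) → List (Fin n)
  vertices s ss = tailS s ∷ map headS (s ∷ ss)

  -- label true = P₁ / C₁ (directed along), false = P₂ / C₂ (directed against)
  monoL : List (Step n a × Bool) → Monomial n a
  monoL = map (λ p → if proj₂ p then yOf (proj₁ p) else ze (edgeOf (proj₁ p)))

  monoR : List (Step n a × Bool) → Monomial n a
  monoR = map (λ p → if proj₂ p then ze (edgeOf (proj₁ p)) else yOf (revS (proj₁ p)))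

  -- The set B of binomials m₁ - m₂
  data InB : Monomial n a → Monomial n a → Set where
    fund1 : ∀ e → InB (yf e ∷ yb e ∷ []) (ze e ∷ ze e ∷ [])
    fund2 : ∀ e → InB (yf e ∷ tv e ∷ []) (zv (proj₁ e) ∷ zv (proj₁ e) ∷ [])
    fund3 : ∀ e → InB (yb e ∷ tv e ∷ []) (zv (sucMod (proj₁ e)) ∷ zv (sucMod (proj₁ e)) ∷ [])
    fund4 : ∀ e → InB (yf e ∷ zv (sucMod (proj₁ e)) ∷ []) (zv (proj₁ e) ∷ ze e ∷ [])
    fund5 : ∀ e → InB (yb e ∷ zv (proj₁ e) ∷ []) (zv (sucMod (proj₁ e)) ∷ ze e ∷ [])
    fund6 : ∀ e → InB (tv e ∷ ze e ∷ []) (zv (proj₁ e) ∷ zv (sucMod (proj₁ e)) ∷ [])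
    -- path s₁ … s₂ from u = tail s₁ to v = head s₂ (length ≥ 2, distinct
    -- vertices), steps directed towards v; s₁ ∈ P₁, s₂ ∈ P₂
    zigzag : ∀ (s₁ : Step n a) (mid : List (Step n a × Bool)) (s₂ : Step n a) →
      let ps = (s₁ , true) ∷ mid ++ (s₂ , false) ∷ []
          ss = map proj₁ ps in
      Chain ss →
      Unique (tailS s₁ ∷ map headS ss) →
      InB (zv (headS s₂) ∷ monoL ps) (zv (tailS s₁) ∷ monoR ps)
    -- cycle of length ≥ 2 with distinct vertices and distinct edges,
    -- oriented along its steps; arbitrary partition C₁ ∪ C₂
    cyclic : ∀ (p₁ p₂ : Step n a × Bool) (rest : List (Step n a × Bool)) →
      let ps = p₁ ∷ p₂ ∷ rest
          ss = map proj₁ ps in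
      Chain (ss ++ proj₁ p₁ ∷ []) →
      Unique (map tailS ss) →
      Unique (map edgeOf ss) →
      InB (monoL ps) (monoR ps)

Subset : (n : ℕ) → (Fin n → ℕ) → Set
Subset n a = Var n a → Bool

allEdges : (n : ℕ) (a : Fin n → ℕ) → List (Edge n a)
allEdges n a = concatMap (λ i → map (i ,_) (allFin (a i))) (allFin n)

allVars : (n : ℕ) (a : Fin n → ℕ) → List (Var n a)
allVars n a = map zv (allFin n) ++
  concatMap (λ e → yf e ∷ yb e ∷ ze e ∷ tv e ∷ []) (allEdges n a)

card : ∀ {n a} → Subset n a → ℕ
card {n} {a} S = length (filterᵇ S (allVars n a))

Contains : ∀ {n a} → Subset n a → Monomial n a → Set
Contains S m = All (λ x → S x ≡ true) m

IsFacet : (n : ℕ) (a : Fin n → ℕ) → Subset n a → Set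
IsFacet n a S = (card S ≡ n + total a) ×
  (∀ m₁ m₂ → InB m₁ m₂ →
     (m₂ <lex m₁ → ¬ Contains S m₁) × (m₁ <lex m₂ → ¬ Contains S m₂))

data Kind : Set where
  kyf kyb kt kz : Kind

varK : ∀ {n a} → Edge n a → Kind → Var n a
varK e kyf = yf e
varK e kyb = yb e
varK e kt = tv e
varK e kz = ze e

contrib : ∀ {n a} → Subset n a → Edge n a → List Kind
contrib S e = filterᵇ (λ k → S (varK e k)) (kyf ∷ kyb ∷ kt ∷ kz ∷ [])

One : List Kind → Kind → Set
One c k = c ≡ k ∷ []

TypeA : ∀ {n a} → Subset n a → Fin n → Set
TypeA {a = a} S i = Σ (Fin (a i)) λ j →
  (contrib S (i , j) ≡ kyf ∷ kz ∷ []) ×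
  (∀ k → k Fin.< j → One (contrib S (i , k)) kt ⊎ One (contrib S (i , k)) kz) ×
  (∀ k → j Fin.< k → One (contrib S (i , k)) kt ⊎ One (contrib S (i , k)) kyf)

TypeB : ∀ {n a} → Subset n a → Fin n → Set
TypeB {a = a} S i = Σ (Fin (a i)) λ j →
  (contrib S (i , j) ≡ kyb ∷ kz ∷ []) ×
  (∀ k → k Fin.< j → One (contrib S (i , k)) kt ⊎ One (contrib S (i , k)) kyb) ×
  (∀ k → j Fin.< k → One (contrib S (i , k)) kt ⊎ One (contrib S (i , k)) kz)

TypeC : ∀ {n a} → Subset n a → Fin n → Set
TypeC {a = a} S i = ∀ (j : Fin (a i)) → length (contrib S (i , j)) ≡ 1

AllYbT : ∀ {n a} → Subset n a → Fin n → Set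
AllYbT {a = a} S i = ∀ (j : Fin (a i)) →
  One (contrib S (i , j)) kyb ⊎ One (contrib S (i , j)) kt

AllZT : ∀ {n a} → Subset n a → Fin n → Set
AllZT {a = a} S i = ∀ (j : Fin (a i)) →
  One (contrib S (i , j)) kz ⊎ One (contrib S (i , j)) kt

Form1 : ∀ {n a} → Subset n a → List (Fin n) → Set
Form1 {n} S xs = Σ (Fin n) λ i → Σ (List (Fin n)) λ ys → Σ (Fin n) λ c →
  Σ (List (Fin n)) λ zs →
  (xs ≡ i ∷ ys ++ c ∷ zs) × TypeA S i × All (λ x → TypeA S x ⊎ TypeB S x) ys ×
  TypeC S c × AllYbT S c × All (TypeB S) zs

Form2 : ∀ {n a} → Subset n a → List (Fin n) → Set
Form2 {n} S xs = Σ (Fin n) λ c → Σ (List (Fin n)) λ zs →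
  (xs ≡ c ∷ zs) × TypeC S c × AllZT S c × All (TypeB S) zs

-- L is the clockwise distance from i to the next vertex j with z_j ∈ S
-- (L = n if z_i is the only one)
IsGap : ∀ {n a} → Subset n a → Fin n → ℕ → Set
IsGap {n} S i L = (1 ≤ L) × (L ≤ n) × (S (zv (shift i L)) ≡ true) ×
  (∀ m → 1 ≤ m → m < L → S (zv (shift i m)) ≡ false)

segment : ∀ {n} → Fin n → ℕ → List (Fin n)
segment i L = map (shift i) (upTo L)

-- Avoiding the leading monomials of the fundamental binomials leaves each edge with ∅, one
-- variable, {→y, z_e} or {←y, z_e}, and the binomials of the 2-cycles inside a multi-edge allow at
-- most one such doubled edge.  Charge multi-edge i with its contributions and with z_{i+1}: it can
-- carry at most a_i + 1, and these bounds add up to n + Σ a_i.  Along the stretch between two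
-- consecutive vertices with z ∈ S, a full (type A or B) multi-edge followed only by full ones would
-- close a clockwise walk of →y- and z_e-variables ending at a z-vertex, whose zig-zag or cyclic binomial
-- has a leading monomial inside S; so every stretch has a deficient multi-edge, and when |S| = n + Σ a_i
-- there is exactly one, which pins down the two forms.  Conversely, for S of the stated shape every
-- stretch is tight, and the leading monomial of each binomial of B contains the smallest →y (or ←y)
-- of its path or cycle; following the path clockwise through the type A/B multi-edges of a form (1)
-- stretch reaches a vertex or multi-edge whose variables S excludes.

module Submission where

open import Defs
open import Data.Nat
open import Data.Nat.Properties
open import Data.Nat.DivMod using (_%_; %-distribˡ-+; m%n%n≡m%n; m<n⇒m%n≡m; m%n<n; m≤n⇒[n∸m]%m≡n%m; n%n≡0; [m+n]%n≡m%n)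
open import Data.Nat.Induction using (<-wellFounded)
open import Algebra.Properties.CommutativeSemigroup +-commutativeSemigroup using (interchange; x∙yz≈y∙xz)
open import Induction.WellFounded using (Acc; acc)
open import Data.Bool using (Bool; true; false; T; if_then_else_)
import Data.Bool
open import Data.Bool.Properties using (T-≡; ¬-not; not-¬)
open import Data.Empty using (⊥; ⊥-elim)
open import Data.Unit using (tt)
open import Data.Fin as Fin using (Fin; toℕ; fromℕ<)
open import Data.Fin.Properties as Fin using (toℕ-fromℕ<; toℕ<n; toℕ-injective; any?; ¬∀⟶∃¬)
open import Data.List using (List; []; _∷_; _++_; map; length; filter; filterᵇ; concatMap; tabulate; allFin; applyUpTo)
open import Data.List.Properties
  using (filter-≐; filter-++; filter-none; length-++; concatMap-++; concatMap-map; map-tabulate; map-applyUpTo; applyUpTo-∷ʳ; ∷-injective)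
open import Data.List.Relation.Unary.All as All using (All; []; _∷_)
import Data.List.Relation.Unary.All.Properties as All
open import Data.List.Relation.Unary.Any as Any using (Any; here; there)
open import Data.List.Relation.Unary.AllPairs using ([]; _∷_)
open import Data.List.Relation.Unary.Unique.Propositional using (Unique)
import Data.List.Relation.Unary.Unique.Propositional.Properties as Unique
open import Data.List.Membership.Propositional using (_∈_; find; lose)
open import Data.List.Membership.Propositional.Properties using (∈-filter⁺; ∈-filter⁻; ∈-map⁺; ∈-++⁺ʳ)
import Data.List.Membership.DecPropositional as DecMembership
open import Data.List.Extrema.Nat using (argmin; argmin-sel; f[argmin]≤f[⊤]; f[argmin]≤f[xs])
open import Data.Product using (Σ; _×_; _,_; proj₁; proj₂)
open import Data.Sum using (_⊎_; inj₁; inj₂; [_,_]′; swap)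
import Data.Sum
open import Function using (_∘_; id)
open import Function.Bundles using (_⇔_; mk⇔; Equivalence)
open import Relation.Nullary using (¬_; Dec; yes; no; does; contradiction)
open import Relation.Nullary.Decidable using (T?; does-⇔; dec-false)
open import Relation.Binary.Definitions using (DecidableEquality; tri<; tri≈; tri>)
open import Relation.Binary.PropositionalEquality

-- Clockwise arithmetic on the vertices

[m%n+k]%n≡[m+k]%n : ∀ m k n .{{_ : NonZero n}} → (m % n + k) % n ≡ (m + k) % n
[m%n+k]%n≡[m+k]%n m k n = begin
  (m % n + k) % n         ≡⟨ %-distribˡ-+ (m % n) k n ⟩
  (m % n % n + k % n) % n ≡⟨ cong (λ x → (x + k % n) % n) (m%n%n≡m%n m n) ⟩
  (m % n + k % n) % n     ≡⟨ %-distribˡ-+ m k n ⟨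
  (m + k) % n             ∎
  where open ≡-Reasoning

[m+d]%n≡m%n⇒d≡0 : ∀ m {d} n .{{_ : NonZero n}} → d < n → (m + d) % n ≡ m % n → d ≡ 0
[m+d]%n≡m%n⇒d≡0 m {d} n d<n eq with m % n + d <? n
... | yes r+d<n = +-cancelˡ-≡ (m % n) d 0 (begin
  m % n + d           ≡⟨ m<n⇒m%n≡m r+d<n ⟨
  (m % n + d) % n     ≡⟨ [m%n+k]%n≡[m+k]%n m d n ⟩
  (m + d) % n         ≡⟨ eq ⟩
  m % n               ≡⟨ +-identityʳ _ ⟨
  m % n + 0           ∎)
  where open ≡-Reasoning
... | no r+d≮n = contradiction r+d∸n≡r (<⇒≢ r+d∸n<r)
  where
  open ≡-Reasoning
  r = m % n
  n≤r+d : n ≤ r + d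
  n≤r+d = ≮⇒≥ r+d≮n
  r+d∸n<r : r + d ∸ n < r
  r+d∸n<r = subst (r + d ∸ n <_) (m+n∸n≡m r n) (∸-monoˡ-< (+-monoʳ-< r d<n) n≤r+d)
  r+d∸n≡r : r + d ∸ n ≡ r
  r+d∸n≡r = begin
    r + d ∸ n         ≡⟨ m<n⇒m%n≡m (<-trans r+d∸n<r (m%n<n m n)) ⟨
    (r + d ∸ n) % n   ≡⟨ m≤n⇒[n∸m]%m≡n%m n≤r+d ⟩
    (r + d) % n       ≡⟨ [m%n+k]%n≡[m+k]%n m d n ⟩
    (m + d) % n       ≡⟨ eq ⟩
    r                 ∎

%-injective-above : ∀ {m k} n .{{_ : NonZero n}} → m ≤ k → k < m + n → m % n ≡ k % n → m ≡ k
%-injective-above {m} {k} n m≤k k<m+n eq = sym (begin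
  k             ≡⟨ m+[n∸m]≡n m≤k ⟨
  m + (k ∸ m)   ≡⟨ cong (m +_) ([m+d]%n≡m%n⇒d≡0 m n k∸m<n (trans (cong (_% n) (m+[n∸m]≡n m≤k)) (sym eq))) ⟩
  m + 0         ≡⟨ +-identityʳ m ⟩
  m             ∎)
  where
  open ≡-Reasoning
  k∸m<n : k ∸ m < n
  k∸m<n = +-cancelˡ-< m (k ∸ m) n (subst (_< m + n) (sym (m+[n∸m]≡n m≤k)) k<m+n)

%-injective-window : ∀ {m k} n .{{_ : NonZero n}} → m < k + n → k < m + n → m % n ≡ k % n → m ≡ k
%-injective-window {m} {k} n m<k+n k<m+n eq with ≤-total m k
... | inj₁ m≤k = %-injective-above n m≤k k<m+n eq
... | inj₂ k≤m = sym (%-injective-above n k≤m m<k+n (sym eq))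

module _ {m : ℕ} where

  private
    N : ℕ
    N = suc m

  toℕ-sucMod : (i : Fin N) → toℕ (sucMod i) ≡ suc (toℕ i) % N
  toℕ-sucMod i with suc (toℕ i) <? N
  ... | yes i+1<N = trans (toℕ-fromℕ< i+1<N) (sym (m<n⇒m%n≡m i+1<N))
  ... | no i+1≮N = sym (trans (cong (_% N) (≤-antisym (toℕ<n i) (≮⇒≥ i+1≮N))) (n%n≡0 N))

  toℕ-shift : (v : Fin N) (p : ℕ) → toℕ (shift v p) ≡ (toℕ v + p) % N
  toℕ-shift v zero = sym (trans (cong (_% N) (+-identityʳ (toℕ v))) (m<n⇒m%n≡m (toℕ<n v)))
  toℕ-shift v (suc p) = begin
    toℕ (sucMod (shift v p))    ≡⟨ toℕ-sucMod (shift v p) ⟩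
    suc (toℕ (shift v p)) % N   ≡⟨ cong (λ x → suc x % N) (toℕ-shift v p) ⟩
    (1 + (toℕ v + p) % N) % N   ≡⟨ cong (_% N) (+-comm 1 _) ⟩
    ((toℕ v + p) % N + 1) % N   ≡⟨ [m%n+k]%n≡[m+k]%n (toℕ v + p) 1 N ⟩
    (toℕ v + p + 1) % N         ≡⟨ cong (_% N) (trans (+-assoc (toℕ v) p 1) (cong (toℕ v +_) (+-comm p 1))) ⟩
    (toℕ v + suc p) % N         ∎
    where open ≡-Reasoning

  shift-+ : (v : Fin N) (p q : ℕ) → shift v (q + p) ≡ shift (shift v p) q
  shift-+ v p zero = refl
  shift-+ v p (suc q) = cong sucMod (shift-+ v p q)

  shift-period : (v : Fin N) → shift v N ≡ v
  shift-period v = toℕ-injective (begin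
    toℕ (shift v N)   ≡⟨ toℕ-shift v N ⟩
    (toℕ v + N) % N   ≡⟨ [m+n]%n≡m%n (toℕ v) N ⟩
    toℕ v % N         ≡⟨ m<n⇒m%n≡m (toℕ<n v) ⟩
    toℕ v             ∎)
    where open ≡-Reasoning

  shift-zero-toℕ : (x : Fin N) → shift Fin.zero (toℕ x) ≡ x
  shift-zero-toℕ x = toℕ-injective (trans (toℕ-shift Fin.zero (toℕ x)) (m<n⇒m%n≡m (toℕ<n x)))

  shift-injective : (v : Fin N) {p q : ℕ} → p < N → q < N → shift v p ≡ shift v q → p ≡ q
  shift-injective v {p} {q} p<N q<N eq = +-cancelˡ-≡ (toℕ v) p q (%-injective-window N
    (subst (toℕ v + p <_) (sym (+-assoc (toℕ v) q N)) (+-monoʳ-< (toℕ v) (<-≤-trans p<N (m≤n+m N q))))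
    (subst (toℕ v + q <_) (sym (+-assoc (toℕ v) p N)) (+-monoʳ-< (toℕ v) (<-≤-trans q<N (m≤n+m N p))))
    (trans (sym (toℕ-shift v p)) (trans (cong toℕ eq) (toℕ-shift v q))))

  sucMod-injective : {x y : Fin N} → sucMod x ≡ sucMod y → x ≡ y
  sucMod-injective {x} {y} eq = toℕ-injective (suc-injective (%-injective-window N
    (+-monoʳ-< 1 (<-≤-trans (toℕ<n x) (m≤n+m N (toℕ y))))
    (+-monoʳ-< 1 (<-≤-trans (toℕ<n y) (m≤n+m N (toℕ x))))
    (trans (sym (toℕ-sucMod x)) (trans (cong toℕ eq) (toℕ-sucMod y)))))

  shift-surjective : (v x : Fin N) → Σ ℕ λ p → p < N × shift v p ≡ x
  shift-surjective v x = p , m%n<n (toℕ x + (N ∸ toℕ v)) N , toℕ-injective (begin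
    toℕ (shift v p)                      ≡⟨ toℕ-shift v p ⟩
    (toℕ v + p) % N                      ≡⟨ cong (_% N) (+-comm (toℕ v) p) ⟩
    (p + toℕ v) % N                      ≡⟨ [m%n+k]%n≡[m+k]%n (toℕ x + (N ∸ toℕ v)) (toℕ v) N ⟩
    (toℕ x + (N ∸ toℕ v) + toℕ v) % N    ≡⟨ cong (_% N) (trans (+-assoc (toℕ x) _ _) (cong (toℕ x +_) (m∸n+n≡m (<⇒≤ (toℕ<n v))))) ⟩
    (toℕ x + N) % N                      ≡⟨ [m+n]%n≡m%n (toℕ x) N ⟩
    toℕ x % N                            ≡⟨ m<n⇒m%n≡m (toℕ<n x) ⟩
    toℕ x                                ∎)
    where
    open ≡-Reasoning
    p = (toℕ x + (N ∸ toℕ v)) % N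

∑ : ∀ {n} → (Fin n → ℕ) → ℕ
∑ {zero} f = 0
∑ {suc n} f = f Fin.zero + ∑ (f ∘ Fin.suc)

∑< : ℕ → (ℕ → ℕ) → ℕ
∑< L f = ∑ {L} (f ∘ toℕ)

δ : ℕ → ℕ → ℕ
δ zero zero = 1
δ zero (suc _) = 0
δ (suc _) zero = 0
δ (suc p₀) (suc p) = δ p₀ p

+-tight : ∀ {a b c d} → a ≤ c → b ≤ d → a + b ≡ c + d → a ≡ c × b ≡ d
+-tight {a} {b} {c} {d} a≤c b≤d eq with m≤n⇒m<n∨m≡n a≤c
... | inj₁ a<c = contradiction eq (<⇒≢ (+-mono-<-≤ a<c b≤d))
... | inj₂ a≡c = a≡c , +-cancelˡ-≡ a b d (trans eq (cong (_+ d) (sym a≡c)))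

∑-cong : ∀ {n} {f g : Fin n → ℕ} → (∀ i → f i ≡ g i) → ∑ f ≡ ∑ g
∑-cong {zero} f≗g = refl
∑-cong {suc n} f≗g = cong₂ _+_ (f≗g Fin.zero) (∑-cong (f≗g ∘ Fin.suc))

∑-distrib-+ : ∀ {n} (f g : Fin n → ℕ) → ∑ (λ i → f i + g i) ≡ ∑ f + ∑ g
∑-distrib-+ {zero} f g = refl
∑-distrib-+ {suc n} f g = trans (cong (f Fin.zero + g Fin.zero +_) (∑-distrib-+ (f ∘ Fin.suc) (g ∘ Fin.suc)))
  (interchange (f Fin.zero) (g Fin.zero) _ _)

∑-mono-≤ : ∀ {n} {f g : Fin n → ℕ} → (∀ i → f i ≤ g i) → ∑ f ≤ ∑ g
∑-mono-≤ {zero} f≤g = z≤n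
∑-mono-≤ {suc n} f≤g = +-mono-≤ (f≤g Fin.zero) (∑-mono-≤ (f≤g ∘ Fin.suc))

∑-tight : ∀ {n} {f g : Fin n → ℕ} → (∀ i → f i ≤ g i) → ∑ f ≡ ∑ g → ∀ i → f i ≡ g i
∑-tight {suc n} f≤g eq Fin.zero = proj₁ (+-tight (f≤g Fin.zero) (∑-mono-≤ (f≤g ∘ Fin.suc)) eq)
∑-tight {suc n} f≤g eq (Fin.suc i) =
  ∑-tight (f≤g ∘ Fin.suc) (proj₂ (+-tight (f≤g Fin.zero) (∑-mono-≤ (f≤g ∘ Fin.suc)) eq)) i

∑-1 : ∀ n → ∑ {n} (λ _ → 1) ≡ n
∑-1 zero = refl
∑-1 (suc n) = cong suc (∑-1 n)

∑<-cong : ∀ {f g : ℕ → ℕ} L → (∀ p → p < L → f p ≡ g p) → ∑< L f ≡ ∑< L g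
∑<-cong L f≗g = ∑-cong (λ i → f≗g (toℕ i) (toℕ<n i))

∑<-mono-≤ : ∀ {f g : ℕ → ℕ} L → (∀ p → p < L → f p ≤ g p) → ∑< L f ≤ ∑< L g
∑<-mono-≤ L f≤g = ∑-mono-≤ (λ i → f≤g (toℕ i) (toℕ<n i))

∑<-tight : ∀ {f g : ℕ → ℕ} L → (∀ p → p < L → f p ≤ g p) → ∑< L f ≡ ∑< L g → ∀ p → p < L → f p ≡ g p
∑<-tight {f} {g} L f≤g eq p p<L =
  subst (λ q → f q ≡ g q) (toℕ-fromℕ< p<L) (∑-tight (λ i → f≤g (toℕ i) (toℕ<n i)) eq (fromℕ< p<L))

∑<-split : ∀ (f : ℕ → ℕ) L M → ∑< (L + M) f ≡ ∑< L f + ∑< M (λ p → f (L + p))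
∑<-split f zero M = refl
∑<-split f (suc L) M = trans (cong (f 0 +_) (∑<-split (f ∘ suc) L M)) (sym (+-assoc (f 0) _ _))

∑<-last : ∀ (f : ℕ → ℕ) L → ∑< (suc L) f ≡ ∑< L f + f L
∑<-last f L = begin
  ∑< (suc L) f                ≡⟨ cong (λ M → ∑< M f) (+-comm 1 L) ⟩
  ∑< (L + 1) f                ≡⟨ ∑<-split f L 1 ⟩
  ∑< L f + (f (L + 0) + 0)    ≡⟨ cong (∑< L f +_) (trans (+-identityʳ _) (cong f (+-identityʳ L))) ⟩
  ∑< L f + f L                ∎
  where open ≡-Reasoning

δ-diag : ∀ p → δ p p ≡ 1
δ-diag zero = refl
δ-diag (suc p) = δ-diag p

δ-≢ : ∀ {p₀ p} → p ≢ p₀ → δ p₀ p ≡ 0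
δ-≢ {zero} {zero} p≢p₀ = contradiction refl p≢p₀
δ-≢ {zero} {suc p} p≢p₀ = refl
δ-≢ {suc p₀} {zero} p≢p₀ = refl
δ-≢ {suc p₀} {suc p} p≢p₀ = δ-≢ (p≢p₀ ∘ cong suc)

∑-0 : ∀ n → ∑ {n} (λ _ → 0) ≡ 0
∑-0 zero = refl
∑-0 (suc n) = ∑-0 n

∑<-δ : ∀ {p₀} L → p₀ < L → ∑< L (δ p₀) ≡ 1
∑<-δ {zero} (suc L) _ = cong suc (∑-0 L)
∑<-δ {suc p₀} (suc L) (s≤s p₀<L) = ∑<-δ L p₀<L

module _ {m : ℕ} where

  private
    N : ℕ
    N = suc m

  ∑<-shift-suc : ∀ (g : Fin N → ℕ) v → ∑< N (g ∘ shift v ∘ suc) ≡ ∑< N (g ∘ shift v)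
  ∑<-shift-suc g v = +-cancelˡ-≡ (g v) _ _ (begin
    ∑< (suc N) (g ∘ shift v)            ≡⟨ ∑<-last (g ∘ shift v) N ⟩
    ∑< N (g ∘ shift v) + g (shift v N)  ≡⟨ cong (λ x → ∑< N (g ∘ shift v) + g x) (shift-period v) ⟩
    ∑< N (g ∘ shift v) + g v            ≡⟨ +-comm _ (g v) ⟩
    g v + ∑< N (g ∘ shift v)            ∎)
    where open ≡-Reasoning

  ∑-rotate : ∀ (g : Fin N → ℕ) v → ∑ g ≡ ∑< N (g ∘ shift v)
  ∑-rotate g v = begin
    ∑ g                                         ≡⟨ ∑-cong (λ x → cong g (sym (shift-zero-toℕ x))) ⟩
    ∑< N (g ∘ shift Fin.zero)                   ≡⟨ from-zero (toℕ v) ⟨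
    ∑< N (g ∘ shift (shift Fin.zero (toℕ v)))   ≡⟨ cong (λ u → ∑< N (g ∘ shift u)) (shift-zero-toℕ v) ⟩
    ∑< N (g ∘ shift v)                          ∎
    where
    open ≡-Reasoning
    from-zero : ∀ k → ∑< N (g ∘ shift (shift Fin.zero k)) ≡ ∑< N (g ∘ shift Fin.zero)
    from-zero zero = refl
    from-zero (suc k) = trans (∑<-cong N (λ p _ → cong g (trans (sym (shift-+ (shift Fin.zero k) 1 p)) (cong (shift (shift Fin.zero k)) (+-comm p 1)))))
      (trans (∑<-shift-suc g (shift Fin.zero k)) (from-zero k))

  ∑-sucMod : ∀ (g : Fin N → ℕ) → ∑ (g ∘ sucMod) ≡ ∑ g
  ∑-sucMod g = trans (∑-rotate (g ∘ sucMod) Fin.zero) (trans (∑<-shift-suc g Fin.zero) (sym (∑-rotate g Fin.zero)))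

∑-1+δ : ∀ {k} (j₀ : Fin k) → ∑ {k} (λ j → suc (δ (toℕ j₀) (toℕ j))) ≡ suc k
∑-1+δ {k} j₀ = begin
  ∑ {k} (λ j → 1 + δ (toℕ j₀) (toℕ j))        ≡⟨ ∑-distrib-+ {k} (λ _ → 1) (λ j → δ (toℕ j₀) (toℕ j)) ⟩
  ∑ {k} (λ _ → 1) + ∑< k (δ (toℕ j₀))         ≡⟨ cong₂ _+_ (∑-1 k) (∑<-δ k (toℕ<n j₀)) ⟩
  k + 1                                       ≡⟨ +-comm k 1 ⟩
  suc k                                       ∎
  where open ≡-Reasoning

total≡∑ : ∀ {n} (f : Fin n → ℕ) → total f ≡ ∑ f
total≡∑ {zero} f = refl
total≡∑ {suc n} f = cong (f Fin.zero +_) (total≡∑ (f ∘ Fin.suc))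

First : (ℕ → Bool) → ℕ → Set
First f L = 1 ≤ L × f L ≡ true × (∀ k → 1 ≤ k → k < L → f k ≡ false)

first-true : ∀ (f : ℕ → Bool) K → (∀ k → 1 ≤ k → k ≤ K → f k ≡ false) ⊎ (Σ ℕ λ L → L ≤ K × First f L)
first-true f zero = inj₁ λ k 1≤k k≤0 → contradiction (≤-trans 1≤k k≤0) λ ()
first-true f (suc K) with first-true f K
... | inj₂ (L , L≤K , first) = inj₂ (L , m≤n⇒m≤1+n L≤K , first)
... | inj₁ none with f (suc K) in fK
...   | true = inj₂ (suc K , ≤-refl , s≤s z≤n , fK , λ k 1≤k k≤K → none k 1≤k (≤-pred k≤K))
...   | false = inj₁ λ k 1≤k k≤K+1 → [ none k 1≤k ∘ ≤-pred , (λ { refl → fK }) ]′ (m≤n⇒m<n∨m≡n k≤K+1)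

first-true-below : ∀ (f : ℕ → Bool) K → 1 ≤ K → f K ≡ true → Σ ℕ λ L → L ≤ K × First f L
first-true-below f K 1≤K fK with first-true f K
... | inj₂ found = found
... | inj₁ none = ⊥-elim (not-¬ fK (none K 1≤K ≤-refl))

-- The marks cut [0, N) into gaps, so a sum over [0, N) is the sum of its gap sums.
module Tiling (Z : ℕ → Bool) (N : ℕ) (Z-N : Z N ≡ true) where

  Gap : ℕ → ℕ → Set
  Gap p L = Z p ≡ true × p + L ≤ N × First (Z ∘ (p +_)) L

  next-gap : ∀ p → p < N → Z p ≡ true → Σ ℕ (Gap p)
  next-gap p p<N Zp with first-true-below (Z ∘ (p +_)) (N ∸ p) (m<n⇒0<n∸m p<N) (subst (λ k → Z k ≡ true) (sym (m+[n∸m]≡n (<⇒≤ p<N))) Z-N)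
  ... | L , L≤N∸p , first = L , Zp , subst (p + L ≤_) (m+[n∸m]≡n (<⇒≤ p<N)) (+-monoʳ-≤ p L≤N∸p) , first

  gap-unique : ∀ {p L L'} → Gap p L → Gap p L' → L ≡ L'
  gap-unique {L = L} {L'} (_ , _ , 1≤L , ZL , ¬Z) (_ , _ , 1≤L' , ZL' , ¬Z') with <-cmp L L'
  ... | tri< L<L' _ _ = ⊥-elim (not-¬ ZL (¬Z' L 1≤L L<L'))
  ... | tri≈ _ L≡L' _ = L≡L'
  ... | tri> _ _ L'<L = ⊥-elim (not-¬ ZL' (¬Z L' 1≤L' L'<L))

  gap-after : ∀ {p L p' L'} → Gap p L → Gap p' L' → p < p' → p + L ≤ p'
  gap-after {p} {L} {p'} (_ , _ , _ , _ , ¬Z) (Zp' , _) p<p' with p + L ≤? p'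
  ... | yes p+L≤p' = p+L≤p'
  ... | no p+L≰p' = ⊥-elim (not-¬ (subst (λ k → Z k ≡ true) (sym (m+[n∸m]≡n (<⇒≤ p<p'))) Zp')
                      (¬Z (p' ∸ p) (m<n⇒0<n∸m p<p') (+-cancelˡ-< p (p' ∸ p) L
                        (subst (_< p + L) (sym (m+[n∸m]≡n (<⇒≤ p<p'))) (≰⇒> p+L≰p')))))

  module _ (w b : ℕ → ℕ) (gap-≤ : ∀ p L → Gap p L → ∑< L (w ∘ (p +_)) ≤ ∑< L (b ∘ (p +_))) where

    private
      Tiled : ℕ → ℕ → Set
      Tiled p d = ∑< d (w ∘ (p +_)) ≤ ∑< d (b ∘ (p +_)) ×
        (∑< d (w ∘ (p +_)) ≡ ∑< d (b ∘ (p +_)) →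
         ∀ p' L' → p ≤ p' → Gap p' L' → ∑< L' (w ∘ (p' +_)) ≡ ∑< L' (b ∘ (p' +_)))

      split : ∀ (f : ℕ → ℕ) p L d → ∑< (L + d) (f ∘ (p +_)) ≡ ∑< L (f ∘ (p +_)) + ∑< d (f ∘ (p + L +_))
      split f p L d = trans (∑<-split (f ∘ (p +_)) L d) (cong (_ +_) (∑<-cong d λ k _ → cong f (sym (+-assoc p L k))))

      tile : ∀ d → Acc _<_ d → ∀ p → p + d ≡ N → Z p ≡ true → Tiled p d
      tile zero _ p p+0≡N _ = z≤n , λ _ p' L' p≤p' (_ , p'+L'≤N , 1≤L' , _) →
        ⊥-elim (<-irrefl refl (<-≤-trans (m<m+n p' 1≤L') (≤-trans p'+L'≤N (≤-trans (≤-reflexive (trans (sym p+0≡N) (+-identityʳ p))) p≤p'))))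
      tile (suc d) (acc rs) p p+d≡N Zp = ≤-part , tight-part
        where
        gap = proj₂ (next-gap p (subst (p <_) p+d≡N (m<m+n p (s≤s z≤n))) Zp)
        L = proj₁ (next-gap p (subst (p <_) p+d≡N (m<m+n p (s≤s z≤n))) Zp)
        1≤L = proj₁ (proj₂ (proj₂ gap))
        L≤d : L ≤ suc d
        L≤d = +-cancelˡ-≤ p L (suc d) (subst (p + L ≤_) (sym p+d≡N) (proj₁ (proj₂ gap)))
        d' = suc d ∸ L
        L+d' : L + d' ≡ suc d
        L+d' = m+[n∸m]≡n L≤d
        rest = tile d' (rs (∸-monoʳ-< {suc d} {L} {0} 1≤L L≤d)) (p + L)
          (trans (+-assoc p L d') (trans (cong (p +_) L+d') p+d≡N)) (proj₁ (proj₂ (proj₂ (proj₂ gap))))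
        split′ : ∀ f → ∑< (suc d) (f ∘ (p +_)) ≡ ∑< L (f ∘ (p +_)) + ∑< d' (f ∘ (p + L +_))
        split′ f = trans (cong (λ k → ∑< k (f ∘ (p +_))) (sym L+d')) (split f p L d')
        ≤-part : ∑< (suc d) (w ∘ (p +_)) ≤ ∑< (suc d) (b ∘ (p +_))
        ≤-part = subst₂ _≤_ (sym (split′ w)) (sym (split′ b)) (+-mono-≤ (gap-≤ p L gap) (proj₁ rest))
        tight-part : ∑< (suc d) (w ∘ (p +_)) ≡ ∑< (suc d) (b ∘ (p +_)) →
                     ∀ p' L' → p ≤ p' → Gap p' L' → ∑< L' (w ∘ (p' +_)) ≡ ∑< L' (b ∘ (p' +_))
        tight-part eq p' L' p≤p' gap' with +-tight (gap-≤ p L gap) (proj₁ rest) (trans (sym (split′ w)) (trans eq (split′ b)))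
        ... | first-tight , rest-tight with m≤n⇒m<n∨m≡n p≤p'
        ...   | inj₂ refl = subst (λ l → ∑< l (w ∘ (p +_)) ≡ ∑< l (b ∘ (p +_))) (gap-unique gap gap') first-tight
        ...   | inj₁ p<p' = proj₂ rest rest-tight p' L' (gap-after gap gap' p<p') gap'

    total-≤ : Z 0 ≡ true → ∑< N w ≤ ∑< N b
    total-≤ Z0 = proj₁ (tile N (<-wellFounded N) 0 refl Z0)

    total-tight⇒gap-tight : Z 0 ≡ true → ∑< N w ≡ ∑< N b → ∀ p L → Gap p L → ∑< L (w ∘ (p +_)) ≡ ∑< L (b ∘ (p +_))
    total-tight⇒gap-tight Z0 tight p L = proj₂ (tile N (<-wellFounded N) 0 refl Z0) tight p L z≤n

last-true : ∀ (f : ℕ → Bool) → f 0 ≡ true → ∀ q → Σ ℕ λ p → p ≤ q × f p ≡ true × (∀ k → p < k → k ≤ q → f k ≡ false)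
last-true f f0 zero = 0 , z≤n , f0 , λ k 0<k k≤0 → contradiction (<-≤-trans 0<k k≤0) (<-irrefl refl)
last-true f f0 (suc q) with f (suc q) in fq
... | true = suc q , ≤-refl , fq , λ k q<k k≤q → contradiction (<-≤-trans q<k k≤q) (<-irrefl refl)
... | false with last-true f f0 q
...   | p , p≤q , fp , after = p , m≤n⇒m≤1+n p≤q , fp ,
        λ k p<k k≤q+1 → [ (λ k<q+1 → after k p<k (≤-pred k<q+1)) , (λ { refl → fq }) ]′ (m≤n⇒m<n∨m≡n k≤q+1)

-- Leading monomials

==ℕ-refl : ∀ k → T (k ==ℕ k)
==ℕ-refl zero = _
==ℕ-refl (suc k) = ==ℕ-refl k

==ℕ-sound : ∀ j k → T (j ==ℕ k) → j ≡ k
==ℕ-sound zero zero _ = refl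
==ℕ-sound (suc j) (suc k) t = cong suc (==ℕ-sound j k t)

module _ {n : ℕ} {a : Fin n → ℕ} where

  private
    Mono = Monomial n a

  ∈⇒0<deg : ∀ {v : Var n a} {m : Mono} → v ∈ m → 0 < deg m v
  ∈⇒0<deg {v} v∈m = ∈⇒0<length (∈-filter⁺ (T? ∘ λ x → rank x ==ℕ rank v) v∈m (==ℕ-refl (rank v)))
    where
    ∈⇒0<length : ∀ {A : Set} {x : A} {xs} → x ∈ xs → 0 < length xs
    ∈⇒0<length (here _) = s≤s z≤n
    ∈⇒0<length (there _) = s≤s z≤n

  deg-≡0 : ∀ (w : Var n a) {m : Mono} → All (λ x → rank x ≢ rank w) m → deg m w ≡ 0
  deg-≡0 w {m} ≢w = cong length (filter-none (T? ∘ λ x → rank x ==ℕ rank w)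
    (All.map (λ ≢ → ≢ ∘ ==ℕ-sound _ _) ≢w))

  deg-rank : ∀ (m : Mono) {v w : Var n a} → rank v ≡ rank w → deg m v ≡ deg m w
  deg-rank m {v} {w} eq = cong (λ r → length (filter (T? ∘ λ x → rank x ==ℕ r) m)) eq

  <lex-leading : ∀ {x : Var n a} {m₁ m₂ : Mono} → x ∈ m₁ → All (λ y → rank x < rank y) m₂ → m₂ <lex m₁
  <lex-leading {x} {m₁} {m₂} x∈m₁ x<m₂ = v , deg-at-v , deg-below-v
    where
    v = argmin rank x m₁
    v≤x : rank v ≤ rank x
    v≤x = f[argmin]≤f[⊤] {f = rank} x m₁
    v∈m₁ : v ∈ m₁
    v∈m₁ with argmin-sel rank x m₁
    ... | inj₁ v≡x = subst (_∈ m₁) (sym v≡x) x∈m₁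
    ... | inj₂ v∈ = v∈
    deg-at-v : deg m₂ v < deg m₁ v
    deg-at-v = subst (_< deg m₁ v) (sym (deg-≡0 v (All.map (λ x<y → >⇒≢ (≤-<-trans v≤x x<y)) x<m₂))) (∈⇒0<deg v∈m₁)
    deg-below-v : ∀ w → rank w < rank v → deg m₁ w ≡ deg m₂ w
    deg-below-v w w<v = trans
      (deg-≡0 w (All.map (λ v≤y → >⇒≢ (<-≤-trans w<v v≤y)) (f[argmin]≤f[xs] {f = rank} x m₁)))
      (sym (deg-≡0 w (All.map (λ x<y → >⇒≢ (<-trans w<v (≤-<-trans v≤x x<y))) x<m₂)))

  <lex-asym : ∀ {m₁ m₂ : Mono} → m₂ <lex m₁ → ¬ m₁ <lex m₂
  <lex-asym {m₁} {m₂} (v , lt , eq) (v' , lt' , eq') with <-cmp (rank v) (rank v')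
  ... | tri< v<v' _ _ = <-irrefl (eq' v v<v') lt
  ... | tri> _ _ v'<v = <-irrefl (eq v' v'<v) lt'
  ... | tri≈ _ v≡v' _ = <-asym lt (subst₂ _<_ (deg-rank m₁ {v'} {v} (sym v≡v')) (deg-rank m₂ {v'} {v} (sym v≡v')) lt')

Obligation : ∀ {n a} → Subset n a → Monomial n a → Monomial n a → Set
Obligation S m₁ m₂ = (m₂ <lex m₁ → ¬ Contains S m₁) × (m₁ <lex m₂ → ¬ Contains S m₂)

AvoidsLeading : ∀ {n a} → Subset n a → Set
AvoidsLeading {n} {a} S = ∀ (m₁ m₂ : Monomial n a) → InB m₁ m₂ → Obligation S m₁ m₂

module _ {n : ℕ} {a : Fin n → ℕ} (S : Subset n a) where

  obligation-leadˡ : ∀ {m₁ m₂ : Monomial n a} (x : Var n a) → x ∈ m₁ → All (λ y → rank x < rank y) m₂ →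
                     ¬ Contains S m₁ → Obligation S m₁ m₂
  obligation-leadˡ {m₁} {m₂} x x∈m₁ x<m₂ ¬S = (λ _ → ¬S) , (λ m₁<m₂ → ⊥-elim (<lex-asym {m₁ = m₁} {m₂} (<lex-leading x∈m₁ x<m₂) m₁<m₂))

  obligation-leadʳ : ∀ {m₁ m₂ : Monomial n a} (x : Var n a) → x ∈ m₂ → All (λ y → rank x < rank y) m₁ →
                     ¬ Contains S m₂ → Obligation S m₁ m₂
  obligation-leadʳ {m₁} {m₂} x x∈m₂ x<m₁ ¬S = (λ m₂<m₁ → ⊥-elim (<lex-asym {m₁ = m₂} {m₁} (<lex-leading x∈m₂ x<m₁) m₂<m₁)) , (λ _ → ¬S)

before+a≤total : ∀ {n} (a : Fin n → ℕ) (i : Fin n) → before a i + a i ≤ total a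
before+a≤total {suc n} a Fin.zero = m≤m+n (a Fin.zero) _
before+a≤total {suc n} a (Fin.suc i) =
  subst (_≤ total a) (sym (+-assoc (a Fin.zero) _ _)) (+-monoʳ-≤ (a Fin.zero) (before+a≤total (a ∘ Fin.suc) i))

varL varR : ∀ {n a} → Step n a × Bool → Var n a
varL p = if proj₂ p then yOf (proj₁ p) else ze (edgeOf (proj₁ p))
varR p = if proj₂ p then ze (edgeOf (proj₁ p)) else yOf (revS (proj₁ p))

module Ranks {n : ℕ} {a : Fin n → ℕ} where

  private
    τ : ℕ
    τ = total a

  pos<total : ∀ (e : Edge n a) → pos e < τ
  pos<total (i , j) = <-≤-trans (+-monoʳ-< (before a i) (toℕ<n j)) (before+a≤total a i)

  total≤rank-yb : ∀ e → τ ≤ rank {a = a} (yb e)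
  total≤rank-yb e = m≤m+n τ _

  2total≤rank-ze : ∀ e → 2 * τ ≤ rank {a = a} (ze e)
  2total≤rank-ze e = m≤m+n (2 * τ) (pos e)

  2total≤rank-zv : ∀ k → 2 * τ ≤ rank {a = a} (zv k)
  2total≤rank-zv k = ≤-trans (*-monoˡ-≤ τ {2} {4} (s≤s (s≤s z≤n))) (m≤m+n (4 * τ) (toℕ k))

  total≤2total : τ ≤ 2 * τ
  total≤2total = m≤m+n τ (τ + 0)

  yf<rank : ∀ e (x : Var n a) → τ ≤ rank x → rank {a = a} (yf e) < rank x
  yf<rank e x τ≤x = <-≤-trans (pos<total e) τ≤x

  yb<rank : ∀ e (x : Var n a) → 2 * τ ≤ rank x → rank {a = a} (yb e) < rank x
  yb<rank e x 2τ≤x = <-≤-trans (+-monoʳ-< τ (∸-monoʳ-< {τ} {suc (pos e)} {0} (s≤s z≤n) (pos<total e)))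
    (subst (_≤ rank x) (cong (τ +_) (+-identityʳ τ)) 2τ≤x)

  ze<zv : ∀ e k → rank {a = a} (ze e) < rank {a = a} (zv k)
  ze<zv e k = <-≤-trans (+-monoʳ-< (2 * τ) (pos<total e))
    (≤-trans (≤-reflexive (+-comm (2 * τ) τ)) (≤-trans (*-monoˡ-≤ τ {3} {4} (s≤s (s≤s (s≤s z≤n)))) (m≤m+n (4 * τ) (toℕ k))))

  yf-mono : ∀ i {j j' : Fin (a i)} → toℕ j < toℕ j' → rank {a = a} (yf (i , j)) < rank {a = a} (yf (i , j'))
  yf-mono i lt = +-monoʳ-< (before a i) lt

  yb-anti : ∀ i {j j' : Fin (a i)} → toℕ j < toℕ j' → rank {a = a} (yb (i , j')) < rank {a = a} (yb (i , j))
  yb-anti i {j} {j'} lt = +-monoʳ-< τ (∸-monoʳ-< {τ} (s≤s (+-monoʳ-< (before a i) lt)) (pos<total (i , j')))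

  yf<ze : ∀ e e' → rank {a = a} (yf e) < rank {a = a} (ze e')
  yf<ze e e' = yf<rank e (ze e') (≤-trans total≤2total (2total≤rank-ze e'))

  yf<zv : ∀ e k → rank {a = a} (yf e) < rank {a = a} (zv k)
  yf<zv e k = yf<rank e (zv k) (≤-trans total≤2total (2total≤rank-zv k))

  yb<ze : ∀ e e' → rank {a = a} (yb e) < rank {a = a} (ze e')
  yb<ze e e' = yb<rank e (ze e') (2total≤rank-ze e')

  yb<zv : ∀ e k → rank {a = a} (yb e) < rank {a = a} (zv k)
  yb<zv e k = yb<rank e (zv k) (2total≤rank-zv k)

  big-varR-fwd : ∀ (pb : Step n a × Bool) → proj₂ (proj₁ pb) ≡ fwd → τ ≤ rank (varR pb)
  big-varR-fwd ((e , fwd) , true) _ = ≤-trans total≤2total (2total≤rank-ze e)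
  big-varR-fwd ((e , fwd) , false) _ = total≤rank-yb e

  big-varL-bwd : ∀ (pb : Step n a × Bool) → proj₂ (proj₁ pb) ≡ bwd → τ ≤ rank (varL pb)
  big-varL-bwd ((e , bwd) , true) _ = total≤rank-yb e
  big-varL-bwd ((e , bwd) , false) _ = ≤-trans total≤2total (2total≤rank-ze e)

_≟ₖ_ : DecidableEquality Kind
kyf ≟ₖ kyf = yes refl
kyf ≟ₖ kyb = no λ ()
kyf ≟ₖ kt = no λ ()
kyf ≟ₖ kz = no λ ()
kyb ≟ₖ kyf = no λ ()
kyb ≟ₖ kyb = yes refl
kyb ≟ₖ kt = no λ ()
kyb ≟ₖ kz = no λ ()
kt ≟ₖ kyf = no λ ()
kt ≟ₖ kyb = no λ ()
kt ≟ₖ kt = yes refl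
kt ≟ₖ kz = no λ ()
kz ≟ₖ kyf = no λ ()
kz ≟ₖ kyb = no λ ()
kz ≟ₖ kt = no λ ()
kz ≟ₖ kz = yes refl

open DecMembership _≟ₖ_ using (_∈?_)

allKinds : List Kind
allKinds = kyf ∷ kyb ∷ kt ∷ kz ∷ []

∈-allKinds : ∀ k → k ∈ allKinds
∈-allKinds kyf = here refl
∈-allKinds kyb = there (here refl)
∈-allKinds kt = there (there (here refl))
∈-allKinds kz = there (there (there (here refl)))

-- The pairs of variables of one edge that form the leading monomial of a fundamental binomial
data Clash : Kind → Kind → Set where
  yf-yb : Clash kyf kyb
  yf-t : Clash kyf kt
  yb-t : Clash kyb kt
  t-z : Clash kt kz

ClashFree : List Kind → Set
ClashFree c = ∀ {k k'} → Clash k k' → k ∈ c → k' ∈ c → ⊥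

data Admissible : List Kind → Set where
  ∅ : Admissible []
  single : ∀ k → Admissible (k ∷ [])
  yf+z : Admissible (kyf ∷ kz ∷ [])
  yb+z : Admissible (kyb ∷ kz ∷ [])

clash-irrefl : ∀ {k} → ¬ Clash k k
clash-irrefl ()

admissible⇒clashFree : ∀ {c} → Admissible c → ClashFree c
admissible⇒clashFree (single k) cl (here refl) (here refl) = clash-irrefl cl
admissible⇒clashFree yf+z cl (here refl) (here refl) = clash-irrefl cl
admissible⇒clashFree yf+z () (here refl) (there (here refl))
admissible⇒clashFree yf+z () (there (here refl)) (here refl)
admissible⇒clashFree yf+z cl (there (here refl)) (there (here refl)) = clash-irrefl cl
admissible⇒clashFree yb+z cl (here refl) (here refl) = clash-irrefl cl
admissible⇒clashFree yb+z () (here refl) (there (here refl))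
admissible⇒clashFree yb+z () (there (here refl)) (here refl)
admissible⇒clashFree yb+z cl (there (here refl)) (there (here refl)) = clash-irrefl cl

select : Bool → Bool → Bool → Bool → Kind → Bool
select b₁ b₂ b₃ b₄ kyf = b₁
select b₁ b₂ b₃ b₄ kyb = b₂
select b₁ b₂ b₃ b₄ kt = b₃
select b₁ b₂ b₃ b₄ kz = b₄

kinds : Bool → Bool → Bool → Bool → List Kind
kinds b₁ b₂ b₃ b₄ = filterᵇ (select b₁ b₂ b₃ b₄) allKinds

clashFree⇒admissible : ∀ b₁ b₂ b₃ b₄ → ClashFree (kinds b₁ b₂ b₃ b₄) → Admissible (kinds b₁ b₂ b₃ b₄)
clashFree⇒admissible true true _ _ cf = ⊥-elim (cf yf-yb (here refl) (there (here refl)))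
clashFree⇒admissible true false true _ cf = ⊥-elim (cf yf-t (here refl) (there (here refl)))
clashFree⇒admissible true false false true _ = yf+z
clashFree⇒admissible true false false false _ = single kyf
clashFree⇒admissible false true true _ cf = ⊥-elim (cf yb-t (here refl) (there (here refl)))
clashFree⇒admissible false true false true _ = yb+z
clashFree⇒admissible false true false false _ = single kyb
clashFree⇒admissible false false true true cf = ⊥-elim (cf t-z (here refl) (there (here refl)))
clashFree⇒admissible false false true false _ = single kt
clashFree⇒admissible false false false true _ = single kz
clashFree⇒admissible false false false false _ = ∅

module _ {n : ℕ} {a : Fin n → ℕ} (S : Subset n a) where

  contrib-≡ : ∀ e → contrib S e ≡ kinds (S (yf e)) (S (yb e)) (S (tv e)) (S (ze e))
  contrib-≡ e = filter-≐ (T? ∘ (S ∘ varK e)) (T? ∘ select _ _ _ _) (subst T (at _) , subst T (sym (at _))) allKinds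
    where
    at : ∀ k → S (varK e k) ≡ select (S (yf e)) (S (yb e)) (S (tv e)) (S (ze e)) k
    at kyf = refl
    at kyb = refl
    at kt = refl
    at kz = refl

  ∈-contrib : ∀ e k → k ∈ contrib S e ⇔ T (S (varK e k))
  ∈-contrib e k = mk⇔ (proj₂ ∘ ∈-filter⁻ (T? ∘ (S ∘ varK e))) (∈-filter⁺ (T? ∘ (S ∘ varK e)) (∈-allKinds k))

  S-at : ∀ {e c} → contrib S e ≡ c → ∀ k → S (varK e k) ≡ does (k ∈? c)
  S-at {e} refl k = sym (does-⇔ (∈-contrib e k) (k ∈? contrib S e) (T? _))

  NoClash : Edge n a → Set
  NoClash e = ∀ {k k'} → Clash k k' → S (varK e k) ≡ true → S (varK e k') ≡ true → ⊥

  noClash⇒admissible : ∀ {e} → NoClash e → Admissible (contrib S e)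
  noClash⇒admissible {e} nc = subst Admissible (sym (contrib-≡ e))
    (clashFree⇒admissible (S (yf e)) (S (yb e)) (S (tv e)) (S (ze e)) (subst ClashFree (contrib-≡ e) clashFree))
    where
    clashFree : ClashFree (contrib S e)
    clashFree cl k∈ k'∈ = nc cl (Equivalence.to T-≡ (Equivalence.to (∈-contrib e _) k∈))
                                (Equivalence.to T-≡ (Equivalence.to (∈-contrib e _) k'∈))

  admissible⇒noClash : ∀ {e} → Admissible (contrib S e) → NoClash e
  admissible⇒noClash {e} adm cl Sk Sk' = admissible⇒clashFree adm cl
    (Equivalence.from (∈-contrib e _) (Equivalence.from T-≡ Sk))
    (Equivalence.from (∈-contrib e _) (Equivalence.from T-≡ Sk'))

  ∉-contrib : ∀ {e} k → S (varK e k) ≡ false → does (k ∈? contrib S e) ≡ false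
  ∉-contrib k = trans (sym (S-at refl k))

length≤2 : ∀ {c} → Admissible c → length c ≤ 2
length≤2 ∅ = z≤n
length≤2 (single k) = s≤s z≤n
length≤2 yf+z = ≤-refl
length≤2 yb+z = ≤-refl

length≡2 : ∀ {c} → Admissible c → length c ≡ 2 → c ≡ kyf ∷ kz ∷ [] ⊎ c ≡ kyb ∷ kz ∷ []
length≡2 yf+z _ = inj₁ refl
length≡2 yb+z _ = inj₂ refl

length≤1-without-y : ∀ {c} → Admissible c → does (kyf ∈? c) ≡ false → does (kyb ∈? c) ≡ false → length c ≤ 1
length≤1-without-y ∅ _ _ = z≤n
length≤1-without-y (single k) _ _ = ≤-refl

length≤1-without-z : ∀ {c} → Admissible c → does (kz ∈? c) ≡ false → length c ≤ 1
length≤1-without-z ∅ _ = z≤n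
length≤1-without-z (single k) _ = ≤-refl

single-without-y : ∀ {c} → Admissible c → length c ≡ 1 → does (kyf ∈? c) ≡ false → does (kyb ∈? c) ≡ false →
                   One c kt ⊎ One c kz
single-without-y (single kt) _ _ _ = inj₁ refl
single-without-y (single kz) _ _ _ = inj₂ refl

single-without-yb-z : ∀ {c} → Admissible c → length c ≡ 1 → does (kyb ∈? c) ≡ false → does (kz ∈? c) ≡ false →
                      One c kt ⊎ One c kyf
single-without-yb-z (single kt) _ _ _ = inj₁ refl
single-without-yb-z (single kyf) _ _ _ = inj₂ refl

single-without-yf-z : ∀ {c} → Admissible c → length c ≡ 1 → does (kyf ∈? c) ≡ false → does (kz ∈? c) ≡ false →
                      One c kt ⊎ One c kyb
single-without-yf-z (single kt) _ _ _ = inj₁ refl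
single-without-yf-z (single kyb) _ _ _ = inj₂ refl

indicator : Bool → ℕ
indicator true = 1
indicator false = 0

count : ∀ {A : Set} → (A → Bool) → List A → ℕ
count p xs = length (filterᵇ p xs)

module _ {A : Set} (p : A → Bool) where

  count-∷ : ∀ x xs → count p (x ∷ xs) ≡ indicator (p x) + count p xs
  count-∷ x xs with p x
  ... | true = refl
  ... | false = refl

  count-swap : ∀ x y xs → count p (x ∷ y ∷ xs) ≡ count p (y ∷ x ∷ xs)
  count-swap x y xs = begin
    count p (x ∷ y ∷ xs)                                 ≡⟨ trans (count-∷ x _) (cong (_ +_) (count-∷ y xs)) ⟩
    indicator (p x) + (indicator (p y) + count p xs)     ≡⟨ x∙yz≈y∙xz (indicator (p x)) (indicator (p y)) (count p xs) ⟩
    indicator (p y) + (indicator (p x) + count p xs)     ≡⟨ trans (count-∷ y _) (cong (_ +_) (count-∷ x xs)) ⟨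
    count p (y ∷ x ∷ xs)                                 ∎
    where open ≡-Reasoning

  count-++ : ∀ xs ys → count p (xs ++ ys) ≡ count p xs + count p ys
  count-++ xs ys = trans (cong length (filter-++ (T? ∘ p) xs ys)) (length-++ (filterᵇ p xs))

  count-tabulate : ∀ {n} (h : Fin n → A) → count p (tabulate h) ≡ ∑ (indicator ∘ p ∘ h)
  count-tabulate {zero} h = refl
  count-tabulate {suc n} h = trans (count-∷ (h Fin.zero) _) (cong (indicator (p (h Fin.zero)) +_) (count-tabulate (h ∘ Fin.suc)))

  count-concatMap : ∀ {B : Set} {n} (f : B → List A) (g : Fin n → B) →
                    count p (concatMap f (tabulate g)) ≡ ∑ (λ i → count p (f (g i)))
  count-concatMap {n = zero} f g = refl
  count-concatMap {n = suc n} f g =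
    trans (count-++ (f (g Fin.zero)) _) (cong (count p (f (g Fin.zero)) +_) (count-concatMap f (g ∘ Fin.suc)))

concatMap-concatMap : ∀ {A B C : Set} (f : B → List C) (g : A → List B) xs →
                      concatMap f (concatMap g xs) ≡ concatMap (concatMap f ∘ g) xs
concatMap-concatMap f g [] = refl
concatMap-concatMap f g (x ∷ xs) = trans (concatMap-++ f (g x) (concatMap g xs)) (cong (concatMap f (g x) ++_) (concatMap-concatMap f g xs))

module _ {n : ℕ} {a : Fin n → ℕ} (S : Subset n a) where

  private
    vars : Edge n a → List (Var n a)
    vars e = yf e ∷ yb e ∷ ze e ∷ tv e ∷ []

  count-vars : ∀ e → count S (vars e) ≡ length (contrib S e)
  count-vars e = begin
    count S (vars e)                                    ≡⟨ expand S (yf e) (yb e) (ze e) (tv e) ⟩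
    ⟦ yf e ⟧ + (⟦ yb e ⟧ + (⟦ ze e ⟧ + (⟦ tv e ⟧ + 0)))   ≡⟨ cong (λ x → ⟦ yf e ⟧ + (⟦ yb e ⟧ + x)) (x∙yz≈y∙xz ⟦ ze e ⟧ ⟦ tv e ⟧ 0) ⟩
    ⟦ yf e ⟧ + (⟦ yb e ⟧ + (⟦ tv e ⟧ + (⟦ ze e ⟧ + 0)))   ≡⟨ expand (S ∘ varK e) kyf kyb kt kz ⟨
    length (contrib S e)                                ∎
    where
    open ≡-Reasoning
    ⟦_⟧ : Var n a → ℕ
    ⟦ v ⟧ = indicator (S v)
    expand : ∀ {A : Set} (p : A → Bool) w x y z →
             count p (w ∷ x ∷ y ∷ z ∷ []) ≡ indicator (p w) + (indicator (p x) + (indicator (p y) + (indicator (p z) + 0)))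
    expand p w x y z = trans (count-∷ p w _) (cong (_ +_) (trans (count-∷ p x _) (cong (_ +_)
      (trans (count-∷ p y _) (cong (_ +_) (count-∷ p z []))))))

  card-≡ : card S ≡ ∑ (λ i → indicator (S (zv i))) + ∑ (λ i → ∑ (λ j → length (contrib S (i , j))))
  card-≡ = begin
    card S
      ≡⟨ count-++ S (map zv (allFin n)) _ ⟩
    count S (map zv (allFin n)) + count S (concatMap vars (allEdges n a))
      ≡⟨ cong₂ _+_ (trans (cong (count S) (map-tabulate id zv)) (count-tabulate S zv))
                    (cong (count S) (concatMap-concatMap vars _ (allFin n))) ⟩
    ∑ (λ i → indicator (S (zv i))) + count S (concatMap (concatMap vars ∘ row) (allFin n))
      ≡⟨ cong (_ +_) (trans (count-concatMap S (concatMap vars ∘ row) id) (∑-cong edges-of-row)) ⟩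
    ∑ (λ i → indicator (S (zv i))) + ∑ (λ i → ∑ (λ j → length (contrib S (i , j)))) ∎
    where
    open ≡-Reasoning
    row : (i : Fin n) → List (Edge n a)
    row i = map (i ,_) (allFin (a i))
    edges-of-row : ∀ i → count S (concatMap vars (row i)) ≡ ∑ (λ j → length (contrib S (i , j)))
    edges-of-row i = trans (cong (count S) (concatMap-map vars (i ,_) (allFin (a i))))
      (trans (count-concatMap S (vars ∘ (i ,_)) id) (∑-cong (λ j → count-vars (i , j))))

module Weights {m : ℕ} {a : Fin (suc m) → ℕ} (S : Subset (suc m) a) where

  private
    N : ℕ
    N = suc m

  ℓ : Edge N a → ℕ
  ℓ e = length (contrib S e)

  cm : Fin N → ℕ
  cm x = ∑ (λ j → ℓ (x , j))

  W : Fin N → ℕ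
  W x = indicator (S (zv (sucMod x))) + cm x

  Bd : Fin N → ℕ
  Bd x = suc (a x)

  card≡∑W : card S ≡ ∑ W
  card≡∑W = begin
    card S                                               ≡⟨ card-≡ S ⟩
    ∑ (λ x → indicator (S (zv x))) + ∑ cm                ≡⟨ cong (_+ ∑ cm) (∑-sucMod (λ x → indicator (S (zv x)))) ⟨
    ∑ (λ x → indicator (S (zv (sucMod x)))) + ∑ cm       ≡⟨ ∑-distrib-+ (λ x → indicator (S (zv (sucMod x)))) cm ⟨
    ∑ W                                                  ∎
    where open ≡-Reasoning

  budget≡∑Bd : N + total a ≡ ∑ Bd
  budget≡∑Bd = trans (cong₂ _+_ (sym (∑-1 N)) (total≡∑ a)) (sym (∑-distrib-+ (λ _ → 1) a))

  gap-z-count : ∀ {i L} → IsGap S i L → ∑< L (λ p → indicator (S (zv (sucMod (shift i p))))) ≡ 1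
  gap-z-count {i} {L} (1≤L , _ , Sz-end , ¬z-inside) = trans (∑<-cong L at) (∑<-δ L (≤-reflexive last≡))
    where
    last≡ : suc (pred L) ≡ L
    last≡ = suc-pred L {{>-nonZero 1≤L}}
    at : ∀ p → p < L → indicator (S (zv (sucMod (shift i p)))) ≡ δ (pred L) p
    at p p<L with p ≟ pred L
    ... | yes refl = trans (cong (λ k → indicator (S (zv (shift i k)))) last≡) (trans (cong indicator Sz-end) (sym (δ-diag (pred L))))
    ... | no p≢last = trans (cong indicator (¬z-inside (suc p) (s≤s z≤n)
            (≤∧≢⇒< p<L (λ p+1≡L → p≢last (cong pred p+1≡L))))) (sym (δ-≢ p≢last))

  ∑W-gap : ∀ {i L} → IsGap S i L → ∀ {p₀} → p₀ < L → ∑< L (W ∘ shift i) ≡ ∑< L (λ p → δ p₀ p + cm (shift i p))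
  ∑W-gap {i} {L} gap {p₀} p₀<L = begin
    ∑< L (W ∘ shift i)                                                         ≡⟨ ∑-distrib-+ {L} _ _ ⟩
    ∑< L (λ p → indicator (S (zv (sucMod (shift i p))))) + ∑< L (cm ∘ shift i)  ≡⟨ cong (_+ _) (trans (gap-z-count gap) (sym (∑<-δ L p₀<L))) ⟩
    ∑< L (δ p₀) + ∑< L (cm ∘ shift i)                                          ≡⟨ ∑-distrib-+ {L} _ _ ⟨
    ∑< L (λ p → δ p₀ p + cm (shift i p))                                       ∎
    where open ≡-Reasoning

  module FromMark (v₀ : Fin N) (Sv₀ : S (zv v₀) ≡ true) where

    Z : ℕ → Bool
    Z p = S (zv (shift v₀ p))

    Z-N : Z N ≡ true
    Z-N = subst (λ v → S (zv v) ≡ true) (sym (shift-period v₀)) Sv₀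

    shift-v₀ : ∀ p k → shift v₀ (p + k) ≡ shift (shift v₀ p) k
    shift-v₀ p k = trans (cong (shift v₀) (+-comm p k)) (shift-+ v₀ p k)

    open Tiling Z N Z-N public

    gap⇒IsGap : ∀ p L → Gap p L → IsGap S (shift v₀ p) L
    gap⇒IsGap p L (_ , p+L≤N , 1≤L , ZL , ¬Z) = 1≤L , ≤-trans (m≤n+m L p) p+L≤N ,
      subst (λ v → S (zv v) ≡ true) (shift-v₀ p L) ZL ,
      λ k 1≤k k<L → subst (λ v → S (zv v) ≡ false) (shift-v₀ p k) (¬Z k 1≤k k<L)

    ∑<-from : ∀ (f : Fin N → ℕ) p L → ∑< L (f ∘ shift v₀ ∘ (p +_)) ≡ ∑< L (f ∘ shift (shift v₀ p))
    ∑<-from f p L = ∑<-cong L λ k _ → cong f (shift-v₀ p k)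

    IsGap⇒Gap : ∀ i → S (zv i) ≡ true → ∀ L → IsGap S i L → ∀ p → p < N → shift v₀ p ≡ i → Gap p L
    IsGap⇒Gap i Szi L (1≤L , _ , Sz-end , ¬z-inside) p p<N v₀+p≡i =
      Zp , p+L≤N , 1≤L , subst (λ v → S (zv v) ≡ true) (sym (at L)) Sz-end ,
      λ k 1≤k k<L → subst (λ v → S (zv v) ≡ false) (sym (at k)) (¬z-inside k 1≤k k<L)
      where
      at : ∀ k → shift v₀ (p + k) ≡ shift i k
      at k = trans (shift-v₀ p k) (cong (λ v → shift v k) v₀+p≡i)
      Zp : Z p ≡ true
      Zp = subst (λ v → S (zv v) ≡ true) (sym v₀+p≡i) Szi
      -- past position N the gap would contain the mark at v₀
      p+L≤N : p + L ≤ N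
      p+L≤N with p + L ≤? N
      ... | yes p+L≤N = p+L≤N
      ... | no p+L≰N = ⊥-elim (not-¬ Sv₀ (trans (cong (S ∘ zv) v₀≡) (¬z-inside k (m<n⇒0<n∸m p<N) k<L)))
        where
        k = N ∸ p
        k<L : k < L
        k<L = +-cancelˡ-< p k L (subst (_< p + L) (sym (m+[n∸m]≡n (<⇒≤ p<N))) (≰⇒> p+L≰N))
        v₀≡ : v₀ ≡ shift i k
        v₀≡ = trans (sym (shift-period v₀)) (trans (cong (shift v₀) (sym (m+[n∸m]≡n (<⇒≤ p<N)))) (at k))

-- Clockwise walks

module _ {n : ℕ} {a : Fin n → ℕ} where

  chain-applyUpTo : ∀ (f : ℕ → Step n a) → (∀ k → headS (f k) ≡ tailS (f (suc k))) → ∀ L → Chain (applyUpTo f L)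
  chain-applyUpTo f linked zero = tt
  chain-applyUpTo f linked (suc zero) = tt
  chain-applyUpTo f linked (suc (suc L)) = linked 0 , chain-applyUpTo (f ∘ suc) (linked ∘ suc) (suc L)

  chain-applyUpTo-∷ʳ : ∀ (f : ℕ → Step n a) → (∀ k → headS (f k) ≡ tailS (f (suc k))) →
                       ∀ L s → headS (f L) ≡ tailS s → Chain (applyUpTo f (suc L) ++ s ∷ [])
  chain-applyUpTo-∷ʳ f linked zero s closed = closed , tt
  chain-applyUpTo-∷ʳ f linked (suc L) s closed = linked 0 , chain-applyUpTo-∷ʳ (f ∘ suc) (linked ∘ suc) L s closed

module ClockwiseWalk {m : ℕ} {a : Fin (suc m) → ℕ} (u : Fin (suc m)) (ch : (p : ℕ) → Fin (a (shift u p))) where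

  private
    N : ℕ
    N = suc m

  step : ℕ → Step N a
  step p = ((shift u p , ch p) , fwd)

  walk : (ℕ → Bool) → ℕ → List (Step N a × Bool)
  walk lab L = applyUpTo (λ p → (step p , lab p)) L

  steps-walk : ∀ lab L → map proj₁ (walk lab L) ≡ applyUpTo step L
  steps-walk lab L = map-applyUpTo _ proj₁ L

  step-linked : ∀ k → headS (step k) ≡ tailS (step (suc k))
  step-linked k = refl

  shift-unique : ∀ L → L ≤ N → Unique (applyUpTo (shift u) L)
  shift-unique L L≤N = Unique.applyUpTo⁺₁ (shift u) L
    (λ i<j j<L eq → <⇒≢ i<j (shift-injective u (<-≤-trans (<-trans i<j j<L) L≤N) (<-≤-trans j<L L≤N) eq))

  vertices-unique : ∀ L → L < N → Unique (tailS (step 0) ∷ map headS (applyUpTo step L))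
  vertices-unique L L<N = subst (λ vs → Unique (u ∷ vs)) (sym (map-applyUpTo step headS L)) (shift-unique (suc L) L<N)

  tails-unique : Unique (map tailS (applyUpTo step N))
  tails-unique = subst Unique (sym (map-applyUpTo step tailS N)) (shift-unique N ≤-refl)

  edges-unique : Unique (map edgeOf (applyUpTo step N))
  edges-unique = Unique.map⁻ {f = proj₁} (subst Unique (sym multi-edges) (shift-unique N ≤-refl))
    where
    multi-edges : map proj₁ (map edgeOf (applyUpTo step N)) ≡ applyUpTo (shift u) N
    multi-edges = trans (cong (map proj₁) (map-applyUpTo step edgeOf N)) (map-applyUpTo (edgeOf ∘ step) proj₁ N)

  closed-chain : Chain (applyUpTo step N ++ step 0 ∷ [])
  closed-chain = chain-applyUpTo-∷ʳ step step-linked m (step 0) (shift-period u)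

applyUpTo-split : ∀ {A : Set} (f : ℕ → A) {L c} → c < L →
                  applyUpTo f L ≡ applyUpTo f c ++ f c ∷ applyUpTo (f ∘ (suc c +_)) (L ∸ suc c)
applyUpTo-split f {suc L} {zero} _ = refl
applyUpTo-split f {suc L} {suc c} (s≤s c<L) = cong (f 0 ∷_) (applyUpTo-split (f ∘ suc) c<L)

applyUpTo-≡-split : ∀ {A : Set} {P Q R : A → Set} (f : ℕ → A) L (ys : List A) c zs →
  applyUpTo f L ≡ ys ++ c ∷ zs → All P ys → Q c → All R zs →
  length ys < L × (∀ k → k < length ys → P (f k)) × Q (f (length ys)) × (∀ k → length ys < k → k < L → R (f k))
applyUpTo-≡-split f (suc L) [] c zs eq [] Qc Rzs with ∷-injective eq
... | refl , rest = s≤s z≤n , (λ k ()) , Qc ,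
  λ { (suc k) _ (s≤s k<L) → All.applyUpTo⁻ (f ∘ suc) L (subst (All _) (sym rest) Rzs) k<L }
applyUpTo-≡-split f (suc L) (y ∷ ys) c zs eq (Py ∷ Pys) Qc Rzs with ∷-injective eq
... | refl , rest with applyUpTo-≡-split (f ∘ suc) L ys c zs rest Pys Qc Rzs
...   | ys<L , Pf , Qf , Rf = s≤s ys<L , (λ { zero _ → Py ; (suc k) (s≤s k<) → Pf k k< }) , Qf ,
        λ { (suc k) (s≤s <k) (s≤s k<L) → Rf k <k k<L }

module _ {n : ℕ} {a : Fin n → ℕ} (S : Subset n a) where

  Form1At : Fin n → ℕ → Set
  Form1At i L = Σ ℕ λ c → 1 ≤ c × c < L × TypeA S i ×
    (∀ p → 1 ≤ p → p < c → TypeA S (shift i p) ⊎ TypeB S (shift i p)) ×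
    (TypeC S (shift i c) × AllYbT S (shift i c)) × (∀ p → c < p → p < L → TypeB S (shift i p))

  Form2At : Fin n → ℕ → Set
  Form2At i L = (TypeC S i × AllZT S i) × (∀ p → 1 ≤ p → p < L → TypeB S (shift i p))

  segment-≡ : ∀ (i : Fin n) L → segment i L ≡ applyUpTo (shift i) L
  segment-≡ i L = map-applyUpTo (λ x → x) (shift i) L

  Form1At⇒Form1 : ∀ i L → Form1At i L → Form1 S (segment i L)
  Form1At⇒Form1 i (suc L) (suc c , _ , s≤s c<L , A , mid , C , after) =
    i , applyUpTo f c , f c , applyUpTo (f ∘ (suc c +_)) (L ∸ suc c) ,
    trans (segment-≡ i (suc L)) (cong (i ∷_) (applyUpTo-split f c<L)) , A ,
    All.applyUpTo⁺₁ f c (λ {k} k<c → mid (suc k) (s≤s z≤n) (s≤s k<c)) , proj₁ C , proj₂ C ,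
    All.applyUpTo⁺₁ _ (L ∸ suc c) (λ {k} k<L∸c → after (suc (suc c + k)) (s≤s (s≤s (m≤m+n c k)))
      (s≤s (subst (suc c + k <_) (m+[n∸m]≡n c<L) (+-monoʳ-< (suc c) k<L∸c))))
    where
    f : ℕ → Fin n
    f k = shift i (suc k)

  Form2At⇒Form2 : ∀ i L → 1 ≤ L → Form2At i L → Form2 S (segment i L)
  Form2At⇒Form2 i (suc L) _ (C , after) = i , applyUpTo (shift i ∘ suc) L , segment-≡ i (suc L) , proj₁ C , proj₂ C ,
    All.applyUpTo⁺₁ _ L (λ {k} k<L → after (suc k) (s≤s z≤n) (s≤s k<L))

  Form1⇒Form1At : ∀ i L → Form1 S (segment i L) → Form1At i L
  Form1⇒Form1At i (suc L) (i' , ys , c , zs , eq , A , mid , C , Yb , after)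
    with ∷-injective (trans (sym (segment-≡ i (suc L))) eq)
  ... | refl , rest with applyUpTo-≡-split {P = λ x → TypeA S x ⊎ TypeB S x} {Q = λ x → TypeC S x × AllYbT S x} {R = TypeB S}
                           (shift i ∘ suc) L ys c zs rest mid (C , Yb) after
  ...   | ys<L , mid' , C' , after' = suc (length ys) , s≤s z≤n , s≤s ys<L , A ,
            (λ { (suc k) _ (s≤s k<) → mid' k k< }) , C' , λ { (suc k) (s≤s <k) (s≤s k<L) → after' k <k k<L }

  Form2⇒Form2At : ∀ i L → Form2 S (segment i L) → Form2At i L
  Form2⇒Form2At i (suc L) (i' , zs , eq , C , ZT , after) with ∷-injective (trans (sym (segment-≡ i (suc L))) eq)
  ... | refl , rest = (C , ZT) , λ { (suc k) _ (s≤s k<L) → All.applyUpTo⁻ (shift i ∘ suc) L (subst (All (TypeB S)) (sym rest) after) k<L }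

dir : ∀ {n a} → Step n a → Dir
dir = proj₂

mult : ∀ {n a} → Step n a → Fin n
mult s = proj₁ (proj₁ s)

_≟ᵈ_ : (d d' : Dir) → Dec (d ≡ d')
fwd ≟ᵈ fwd = yes refl
fwd ≟ᵈ bwd = no λ ()
bwd ≟ᵈ fwd = no λ ()
bwd ≟ᵈ bwd = yes refl

module _ {m : ℕ} {a : Fin (suc m) → ℕ} where

  private
    St = Step (suc m) a

  turn-back : ∀ (t t' : St) → headS t ≡ tailS t' → dir t ≢ dir t' → headS t' ≡ tailS t
  turn-back ((x , j) , fwd) ((x' , j') , fwd) _ d≢d' = contradiction refl d≢d'
  turn-back ((x , j) , fwd) ((x' , j') , bwd) eq _ = sym (sucMod-injective eq)
  turn-back ((x , j) , bwd) ((x' , j') , fwd) eq _ = cong sucMod (sym eq)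
  turn-back ((x , j) , bwd) ((x' , j') , bwd) _ d≢d' = contradiction refl d≢d'

  path-direction : ∀ (t : St) ts → Chain (t ∷ ts) → Unique (tailS t ∷ map headS (t ∷ ts)) → All (λ s → dir s ≡ dir t) (t ∷ ts)
  path-direction t [] _ _ = refl ∷ []
  path-direction t (t' ∷ ts) (linked , chain) ((_ ∷ tail≢head' ∷ _) ∷ unique) with dir t ≟ᵈ dir t'
  ... | no d≢d' = contradiction (sym (turn-back t t' linked d≢d')) tail≢head'
  ... | yes d≡d' = refl ∷ All.map (λ eq → trans eq (sym d≡d'))
        (path-direction t' ts chain (subst (λ v → Unique (v ∷ map headS (t' ∷ ts))) linked unique))

  private
    following : St → List St → St
    following y [] = y
    following y (t ∷ _) = t

    linked-following : ∀ (t : St) ts y → Chain (t ∷ ts ++ y ∷ []) → headS t ≡ tailS (following y ts)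
    linked-following t [] y (linked , _) = linked
    linked-following t (t' ∷ ts) y (linked , _) = linked

  closed-direction : ∀ (y : St) ys x₀ → Chain (y ∷ ys ++ x₀ ∷ []) → Unique (tailS x₀ ∷ map tailS (y ∷ ys)) →
                     All (λ s → dir s ≡ dir y) (y ∷ ys)
  closed-direction y [] x₀ _ _ = refl ∷ []
  closed-direction y (y' ∷ ys) x₀ (linked , chain) ((x₀≢ ∷ x₀≢') ∷ y≢ ∷ unique) with dir y ≟ᵈ dir y'
  ... | no d≢d' = contradiction (trans (sym (turn-back y y' linked d≢d')) (linked-following y' ys x₀ chain)) (repeat ys y≢)
    where
    repeat : ∀ ys → All (tailS y ≢_) (tailS y' ∷ map tailS ys) → tailS y ≢ tailS (following x₀ ys)
    repeat [] _ eq = x₀≢ (sym eq)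
    repeat (t ∷ ts) (_ ∷ y≢t ∷ _) = y≢t
  ... | yes d≡d' = refl ∷ All.map (λ eq → trans eq (sym d≡d')) (closed-direction y' ys x₀ chain (x₀≢' ∷ unique))

  cycle-direction : ∀ (t₀ t₁ t₂ : St) rest → Chain (t₀ ∷ t₁ ∷ t₂ ∷ rest ++ t₀ ∷ []) →
                    Unique (map tailS (t₀ ∷ t₁ ∷ t₂ ∷ rest)) → All (λ s → dir s ≡ dir t₀) (t₀ ∷ t₁ ∷ t₂ ∷ rest)
  cycle-direction t₀ t₁ t₂ rest (linked , linked' , chain) unique@((_ ∷ t₀≢t₂ ∷ _) ∷ _) with dir t₀ ≟ᵈ dir t₁
  ... | no d≢d' = contradiction (trans (sym (turn-back t₀ t₁ linked d≢d')) linked') t₀≢t₂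
  ... | yes d≡d' = refl ∷ All.map (λ eq → trans eq (sym d≡d')) (closed-direction t₁ (t₂ ∷ rest) t₀ (linked' , chain) unique)

  private
    successor′ : ∀ (ss : List St) y → Chain (ss ++ y ∷ []) → ∀ {t} → t ∈ ss →
                 Σ St λ t' → (t' ∈ ss ⊎ t' ≡ y) × headS t ≡ tailS t'
    successor′ (t ∷ []) y (linked , _) (here refl) = y , inj₂ refl , linked
    successor′ (t ∷ t' ∷ ss) y (linked , _) (here refl) = t' , inj₁ (there (here refl)) , linked
    successor′ (t ∷ t' ∷ ss) y (_ , chain) (there t∈) with successor′ (t' ∷ ss) y chain t∈
    ... | t'' , inj₁ t''∈ , linked = t'' , inj₁ (there t''∈) , linked
    ... | t'' , inj₂ t''≡y , linked = t'' , inj₂ t''≡y , linked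

  successor : ∀ (ss : List St) t₀ → t₀ ∈ ss → Chain (ss ++ t₀ ∷ []) → ∀ {t} → t ∈ ss →
              Σ St λ t' → t' ∈ ss × headS t ≡ tailS t'
  successor ss t₀ t₀∈ chain t∈ with successor′ ss t₀ chain t∈
  ... | t' , inj₁ t'∈ , linked = t' , t'∈ , linked
  ... | t' , inj₂ refl , linked = t' , t₀∈ , linked

  Covers : List St → Set
  Covers ss = ∀ x → Σ St λ s → s ∈ ss × mult s ≡ x

  covers-fwd : ∀ ss (t₀ : St) → t₀ ∈ ss → Chain (ss ++ t₀ ∷ []) → All (λ s → dir s ≡ fwd) ss → Covers ss
  covers-fwd ss t₀ t₀∈ chain fwds x with shift-surjective (mult t₀) x
  ... | k , _ , reach = subst (λ y → Σ St λ s → s ∈ ss × mult s ≡ y) reach (go k)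
    where
    go : ∀ k → Σ St λ s → s ∈ ss × mult s ≡ shift (mult t₀) k
    go zero = t₀ , t₀∈ , refl
    go (suc k) with go k
    ... | s@((_ , _) , fwd) , s∈ , at with successor ss t₀ t₀∈ chain s∈
    ...   | t'@((_ , _) , fwd) , t'∈ , linked = t' , t'∈ , trans (sym linked) (cong sucMod at)
    ...   | ((_ , _) , bwd) , t'∈ , _ = contradiction (All.lookup fwds t'∈) λ ()
    go (suc k) | ((_ , _) , bwd) , s∈ , _ = contradiction (All.lookup fwds s∈) λ ()

  covers-bwd : ∀ ss (t₀ : St) → t₀ ∈ ss → Chain (ss ++ t₀ ∷ []) → All (λ s → dir s ≡ bwd) ss → Covers ss
  covers-bwd ss t₀ t₀∈ chain bwds x with shift-surjective x (mult t₀)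
  ... | k , _ , reach = go k (t₀ , t₀∈ , sym reach)
    where
    go : ∀ k → (Σ St λ s → s ∈ ss × mult s ≡ shift x k) → Σ St λ s → s ∈ ss × mult s ≡ x
    go zero found = found
    go (suc k) (s@((_ , _) , bwd) , s∈ , at) with successor ss t₀ t₀∈ chain s∈
    ... | t'@((_ , _) , bwd) , t'∈ , linked = go k (t' , t'∈ , sucMod-injective (trans (sym linked) at))
    ... | ((_ , _) , fwd) , t'∈ , _ = contradiction (All.lookup bwds t'∈) λ ()
    go (suc k) (((_ , _) , fwd) , s∈ , _) = contradiction (All.lookup bwds s∈) λ ()

-- Facets have the stated shape

module Forward {m : ℕ} (a : Fin (suc (suc m)) → ℕ) (S : Subset (suc (suc m)) a) (avoid : AvoidsLeading S) where

  N : ℕ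
  N = suc (suc m)

  open Ranks {N} {a}

  excludedˡ : ∀ {m₁ m₂} (x : Var N a) → InB m₁ m₂ → x ∈ m₁ → All (λ y → rank x < rank y) m₂ → ¬ Contains S m₁
  excludedˡ x b x∈m₁ x<m₂ = proj₁ (avoid _ _ b) (<lex-leading x∈m₁ x<m₂)

  excludedʳ : ∀ {m₁ m₂} (x : Var N a) → InB m₁ m₂ → x ∈ m₂ → All (λ y → rank x < rank y) m₁ → ¬ Contains S m₂
  excludedʳ x b x∈m₂ x<m₁ = proj₂ (avoid _ _ b) (<lex-leading x∈m₂ x<m₁)

  no-clash : ∀ e → NoClash S e
  no-clash e yf-yb Syf Syb = excludedˡ (yf e) (fund1 e) (here refl) (yf<ze e e ∷ yf<ze e e ∷ []) (Syf ∷ Syb ∷ [])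
  no-clash e yf-t Syf St = excludedˡ (yf e) (fund2 e) (here refl) (yf<zv e _ ∷ yf<zv e _ ∷ []) (Syf ∷ St ∷ [])
  no-clash e yb-t Syb St = excludedˡ (yb e) (fund3 e) (here refl) (yb<zv e _ ∷ yb<zv e _ ∷ []) (Syb ∷ St ∷ [])
  no-clash e t-z St Sz = excludedˡ (ze e) (fund6 e) (there (here refl)) (ze<zv e _ ∷ ze<zv e _ ∷ []) (St ∷ Sz ∷ [])

  yf⇒¬z-head : ∀ e → S (yf e) ≡ true → S (zv (sucMod (proj₁ e))) ≡ true → ⊥
  yf⇒¬z-head e Syf Sz = excludedˡ (yf e) (fund4 e) (here refl) (yf<zv e _ ∷ yf<ze e e ∷ []) (Syf ∷ Sz ∷ [])

  yb⇒¬z-tail : ∀ e → S (yb e) ≡ true → S (zv (proj₁ e)) ≡ true → ⊥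
  yb⇒¬z-tail e Syb Sz = excludedˡ (yb e) (fund5 e) (here refl) (yb<zv e _ ∷ yb<ze e e ∷ []) (Syb ∷ Sz ∷ [])

  i≢sucMod-i : ∀ (i : Fin N) → i ≢ sucMod i
  i≢sucMod-i i eq = 0≢1+n (shift-injective i (s≤s z≤n) (s≤s (s≤s z≤n)) eq)

  two-cycle : ∀ i {j j' : Fin (a i)} → j ≢ j' → ∀ b b' →
    InB {N} {a} (monoL ((((i , j) , fwd) , b) ∷ (((i , j') , bwd) , b') ∷ []))
                (monoR ((((i , j) , fwd) , b) ∷ (((i , j') , bwd) , b') ∷ []))
  two-cycle i {j} {j'} j≢j' b b' = cyclic (((i , j) , fwd) , b) (((i , j') , bwd) , b') [] (refl , refl , tt) ((i≢sucMod-i i ∷ []) ∷ [] ∷ [])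
    (((λ { refl → j≢j' refl }) ∷ []) ∷ [] ∷ [])

  yf⇒¬yb : ∀ i {j j' : Fin (a i)} → S (yf (i , j)) ≡ true → S (yb (i , j')) ≡ true → ⊥
  yf⇒¬yb i {j} {j'} Syf Syb with j Fin.≟ j'
  ... | yes refl = no-clash (i , j) yf-yb Syf Syb
  ... | no j≢j' = excludedˡ (yf (i , j)) (two-cycle i j≢j' true true) (here refl)
    (yf<ze (i , j) (i , j) ∷ yf<ze (i , j) (i , j') ∷ []) (Syf ∷ Syb ∷ [])

  yf⇒¬ze-after : ∀ i {j j' : Fin (a i)} → toℕ j < toℕ j' → S (yf (i , j)) ≡ true → S (ze (i , j')) ≡ true → ⊥
  yf⇒¬ze-after i {j} {j'} j<j' Syf Sze = excludedˡ (yf (i , j)) (two-cycle i (<⇒≢ j<j' ∘ cong toℕ) true false) (here refl)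
    (yf<ze (i , j) (i , j) ∷ yf-mono i j<j' ∷ []) (Syf ∷ Sze ∷ [])

  yb⇒¬ze-before : ∀ i {j j' : Fin (a i)} → toℕ j < toℕ j' → S (yb (i , j')) ≡ true → S (ze (i , j)) ≡ true → ⊥
  yb⇒¬ze-before i {j} {j'} j<j' Syb Sze = excludedˡ (yb (i , j')) (two-cycle i (<⇒≢ j<j' ∘ cong toℕ) false true) (there (here refl))
    (yb-anti i j<j' ∷ yb<ze (i , j') (i , j') ∷ []) (Sze ∷ Syb ∷ [])

  open Weights S

  admissible : ∀ e → Admissible (contrib S e)
  admissible e = noClash⇒admissible S (no-clash e)

  S-doubled : ∀ e → ℓ e ≡ 2 → (S (yf e) ≡ true ⊎ S (yb e) ≡ true) × S (ze e) ≡ true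
  S-doubled e ℓ≡2 with length≡2 (admissible e) ℓ≡2
  ... | inj₁ c≡yf+z = inj₁ (S-at S c≡yf+z kyf) , S-at S c≡yf+z kz
  ... | inj₂ c≡yb+z = inj₂ (S-at S c≡yb+z kyb) , S-at S c≡yb+z kz

  doubled-before : ∀ x {j j' : Fin (a x)} → toℕ j < toℕ j' → ℓ (x , j) ≡ 2 → ℓ (x , j') ≡ 2 → ⊥
  doubled-before x j<j' ℓ≡2 ℓ'≡2 with S-doubled _ ℓ≡2 | S-doubled _ ℓ'≡2
  ... | inj₁ Syf , _ | _ , Sze' = yf⇒¬ze-after x j<j' Syf Sze'
  ... | inj₂ Syb , _ | inj₁ Syf' , _ = yf⇒¬yb x Syf' Syb
  ... | inj₂ _ , Sze | inj₂ Syb' , _ = yb⇒¬ze-before x j<j' Syb' Sze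

  doubled-unique : ∀ x {j j' : Fin (a x)} → j ≢ j' → ℓ (x , j) ≡ 2 → ℓ (x , j') ≡ 2 → ⊥
  doubled-unique x {j} {j'} j≢j' ℓ≡2 ℓ'≡2 with <-cmp (toℕ j) (toℕ j')
  ... | tri< j<j' _ _ = doubled-before x j<j' ℓ≡2 ℓ'≡2
  ... | tri≈ _ j≡j' _ = j≢j' (toℕ-injective j≡j')
  ... | tri> _ _ j'<j = doubled-before x j'<j ℓ'≡2 ℓ≡2

  ℓ≤1+δ : ∀ x {j₀} → ℓ (x , j₀) ≡ 2 → ∀ j → ℓ (x , j) ≤ suc (δ (toℕ j₀) (toℕ j))
  ℓ≤1+δ x {j₀} ℓ₀≡2 j with j Fin.≟ j₀
  ... | yes refl = subst (λ k → k ≤ suc (δ (toℕ j₀) (toℕ j₀))) (sym ℓ₀≡2) (s≤s (≤-reflexive (sym (δ-diag (toℕ j₀)))))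
  ... | no j≢j₀ = ≤-trans (≤-pred (≤∧≢⇒< (length≤2 (admissible (x , j))) (λ ℓ≡2 → doubled-unique x j≢j₀ ℓ≡2 ℓ₀≡2))) (s≤s z≤n)

  doubled? : ∀ x → (Σ (Fin (a x)) λ j₀ → ℓ (x , j₀) ≡ 2) ⊎ (∀ j → ℓ (x , j) ≤ 1)
  doubled? x with any? (λ j → ℓ (x , j) ≟ 2)
  ... | yes found = inj₁ found
  ... | no no-doubled = inj₂ λ j → ≤-pred (≤∧≢⇒< (length≤2 (admissible (x , j))) (λ ℓ≡2 → no-doubled (j , ℓ≡2)))

  cm≤1+a : ∀ x → cm x ≤ suc (a x)
  cm≤1+a x with doubled? x
  ... | inj₁ (j₀ , ℓ₀≡2) = ≤-trans (∑-mono-≤ (ℓ≤1+δ x ℓ₀≡2)) (≤-reflexive (∑-1+δ j₀))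
  ... | inj₂ ℓ≤1 = ≤-trans (∑-mono-≤ ℓ≤1) (≤-trans (≤-reflexive (∑-1 (a x))) (n≤1+n (a x)))

  Full : Fin N → Set
  Full x = cm x ≡ suc (a x)

  undoubled : ∀ x → Full x → ∀ {j₀} → ℓ (x , j₀) ≡ 2 → ∀ j → toℕ j ≢ toℕ j₀ → ℓ (x , j) ≡ 1
  undoubled x full {j₀} ℓ₀≡2 j j≢j₀ =
    trans (∑-tight (ℓ≤1+δ x ℓ₀≡2) (trans full (sym (∑-1+δ j₀))) j) (cong suc (δ-≢ j≢j₀))

  full⇒A⊎B : ∀ x → Full x → TypeA S x ⊎ TypeB S x
  full⇒A⊎B x full with doubled? x
  ... | inj₂ ℓ≤1 = contradiction (≤-trans (≤-reflexive (sym full)) (≤-trans (∑-mono-≤ ℓ≤1) (≤-reflexive (∑-1 (a x))))) 1+n≰n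
  ... | inj₁ (j₀ , ℓ₀≡2) with length≡2 (admissible (x , j₀)) ℓ₀≡2
  ...   | inj₁ c₀ = inj₁ (j₀ , c₀ ,
          (λ k k<j₀ → single-without-y (admissible (x , k)) (undoubled x full ℓ₀≡2 k (<⇒≢ k<j₀))
             (∉-contrib S kyf (¬-not λ Syf → yf⇒¬ze-after x k<j₀ Syf (S-at S c₀ kz)))
             (∉-contrib S kyb (¬-not λ Syb → yf⇒¬yb x (S-at S c₀ kyf) Syb))) ,
          (λ k j₀<k → single-without-yb-z (admissible (x , k)) (undoubled x full ℓ₀≡2 k (<⇒≢ j₀<k ∘ sym))
             (∉-contrib S kyb (¬-not λ Syb → yf⇒¬yb x (S-at S c₀ kyf) Syb))
             (∉-contrib S kz (¬-not λ Sze → yf⇒¬ze-after x j₀<k (S-at S c₀ kyf) Sze))))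
  ...   | inj₂ c₀ = inj₂ (j₀ , c₀ ,
          (λ k k<j₀ → single-without-yf-z (admissible (x , k)) (undoubled x full ℓ₀≡2 k (<⇒≢ k<j₀))
             (∉-contrib S kyf (¬-not λ Syf → yf⇒¬yb x Syf (S-at S c₀ kyb)))
             (∉-contrib S kz (¬-not λ Sze → yb⇒¬ze-before x k<j₀ (S-at S c₀ kyb) Sze))) ,
          (λ k j₀<k → single-without-y (admissible (x , k)) (undoubled x full ℓ₀≡2 k (<⇒≢ j₀<k ∘ sym))
             (∉-contrib S kyf (¬-not λ Syf → yf⇒¬yb x Syf (S-at S c₀ kyb)))
             (∉-contrib S kyb (¬-not λ Syb → yb⇒¬ze-before x j₀<k Syb (S-at S c₀ kz)))))

  module Walks (u : Fin N) (ch : (p : ℕ) → Fin (a (shift u p))) where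
    open ClockwiseWalk {a = a} u ch public

    InS : (ℕ → Bool) → ℕ → Set
    InS lab r = ∀ k → k < r → S (varL (step k , lab k)) ≡ true

    all-walk : ∀ {P : Step N a × Bool → Set} lab r → (∀ {k} → k < r → P (step k , lab k)) → All P (walk lab r)
    all-walk lab r = All.applyUpTo⁺₁ _ r

    yf₀ : Var N a
    yf₀ = yf (u , ch 0)

    yf₀<varR : ∀ lab r → All (λ y → rank yf₀ < rank y) (monoR (walk lab r))
    yf₀<varR lab r = All.map⁺ (all-walk lab r λ {k} _ → yf<rank (u , ch 0) (varR (step k , lab k)) (big-varR-fwd (step k , lab k) refl))

    closed-walk : ∀ lab → InB (monoL (walk lab N)) (monoR (walk lab N))
    closed-walk lab = cyclic (step 0 , lab 0) (step 1 , lab 1) (applyUpTo (λ p → step (2 + p) , lab (2 + p)) m)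
      (subst (λ ss → Chain (ss ++ step 0 ∷ [])) (sym (steps-walk lab N)) closed-chain)
      (subst (Unique ∘ map tailS) (sym (steps-walk lab N)) tails-unique)
      (subst (Unique ∘ map edgeOf) (sym (steps-walk lab N)) edges-unique)

    closed-walk-yf : ∀ lab → lab 0 ≡ true → InS lab N → ⊥
    closed-walk-yf lab lab₀ inS = excludedˡ yf₀ (closed-walk lab) yf₀∈ (yf₀<varR lab N)
      (All.map⁺ (all-walk lab N (inS _)))
      where
      yf₀∈ : yf₀ ∈ monoL (walk lab N)
      yf₀∈ = here (cong (λ b → if b then yf₀ else ze (u , ch 0)) (sym lab₀))

    closed-walk-yb : (∀ k → k < N → S (yb (shift u k , ch k)) ≡ true) → ⊥
    closed-walk-yb Syb = excludedʳ (yb (u , ch 0)) (closed-walk (λ _ → false)) (here refl)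
      (All.map⁺ (all-walk (λ _ → false) N λ {k} _ → yb<ze (u , ch 0) (shift u k , ch k)))
      (All.map⁺ (all-walk (λ _ → false) N (Syb _)))

    no-walk-to-z : ∀ lab r → 1 ≤ r → r ≤ N → lab 0 ≡ true → InS lab r → S (zv (shift u r)) ≡ true → ⊥
    no-walk-to-z lab (suc r) _ r<N lab₀ inS Sz with lab r in lab-r
    ... | true = yf⇒¬z-head (shift u r , ch r) (subst (λ b → S (varL (step r , b)) ≡ true) lab-r (inS r ≤-refl)) Sz
    no-walk-to-z lab (suc zero) _ r<N lab₀ inS Sz | false = ⊥-elim (not-¬ lab₀ lab-r)
    no-walk-to-z lab (suc (suc c)) _ r<N lab₀ inS Sz | false with suc (suc c) <? N
    ... | no r≮N = closed-walk-yf lab lab₀ (subst (InS lab) (≤-antisym r<N (≮⇒≥ r≮N)) inS)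
    ... | yes r+1<N = excludedˡ yf₀ zz (there (here refl))
      (yf<zv (u , ch 0) u ∷ subst (All (λ y → rank yf₀ < rank y) ∘ monoR) (sym path≡walk) (yf₀<varR lab _))
      (Sz ∷ subst (Contains S ∘ monoL) (sym path≡walk) (All.map⁺ (all-walk lab _ (inS _))))
      where
      mid = applyUpTo (λ p → step (suc p) , lab (suc p)) c
      path = (step 0 , true) ∷ mid ++ (step (suc c) , false) ∷ []
      path≡walk : path ≡ walk lab (suc (suc c))
      path≡walk = cong₂ _∷_ (cong (step 0 ,_) (sym lab₀))
        (trans (cong (λ b → mid ++ (step (suc c) , b) ∷ []) (sym lab-r)) (applyUpTo-∷ʳ _ c))
      steps≡ : map proj₁ path ≡ applyUpTo step (suc (suc c))
      steps≡ = trans (cong (map proj₁) path≡walk) (steps-walk lab _)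
      zz : InB (zv (headS (step (suc c))) ∷ monoL path) (zv (tailS (step 0)) ∷ monoR path)
      zz = zigzag (step 0) mid (step (suc c))
        (subst Chain (sym steps≡) (chain-applyUpTo step step-linked _))
        (subst (λ ss → Unique (u ∷ map headS ss)) (sym steps≡) (vertices-unique _ r+1<N))

  module Gaps (ha : ∀ i → 1 ≤ a i) where

    full? : ∀ x → Dec (Full x)
    full? x = cm x ≟ suc (a x)

    double : ∀ {x} → TypeA S x ⊎ TypeB S x → Fin (a x) × Bool
    double (inj₁ (j , _)) = j , true
    double (inj₂ (j , _)) = j , false

    double-ze : ∀ {x} (t : TypeA S x ⊎ TypeB S x) → S (ze (x , proj₁ (double t))) ≡ true
    double-ze (inj₁ (j , c , _)) = S-at S c kz
    double-ze (inj₂ (j , c , _)) = S-at S c kz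

    double-varL : ∀ {x} (t : TypeA S x ⊎ TypeB S x) → S (varL (((x , proj₁ (double t)) , fwd) , proj₂ (double t))) ≡ true
    double-varL (inj₁ (j , c , _)) = S-at S c kyf
    double-varL (inj₂ (j , c , _)) = S-at S c kz

    -- the doubled edge of a full multi-edge, with label true for type A (a walk may use its →y-variable)
    -- and false for type B (a walk uses its z-variable)
    pick : ∀ x → Dec (Full x) → Fin (a x) × Bool
    pick x (yes full) = double (full⇒A⊎B x full)
    pick x (no _) = Fin.fromℕ< (ha x) , false

    edge : ∀ x → Fin (a x)
    edge x = proj₁ (pick x (full? x))

    label : Fin N → Bool
    label x = proj₂ (pick x (full? x))

    edge-ze : ∀ x → Full x → S (ze (x , edge x)) ≡ true
    edge-ze x full with full? x
    ... | yes full' = double-ze (full⇒A⊎B x full')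
    ... | no ¬full = contradiction full ¬full

    edge-varL : ∀ x → Full x → S (varL (((x , edge x) , fwd) , label x)) ≡ true
    edge-varL x full with full? x
    ... | yes full' = double-varL (full⇒A⊎B x full')
    ... | no ¬full = contradiction full ¬full

    z⇒¬B : ∀ x → S (zv x) ≡ true → ¬ TypeB S x
    z⇒¬B x Sz (j , c , _) = yb⇒¬z-tail (x , j) (S-at S c kyb) Sz

    label-at-z : ∀ x → S (zv x) ≡ true → Full x → label x ≡ true
    label-at-z x Sz full with full? x
    ... | no ¬full = contradiction full ¬full
    ... | yes full' with full⇒A⊎B x full'
    ...   | inj₁ _ = refl
    ...   | inj₂ B = ⊥-elim (z⇒¬B x Sz B)

    all-single : ∀ x → cm x ≡ a x → (∀ j → ℓ (x , j) ≤ 1) → TypeC S x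
    all-single x cm≡a ℓ≤1 = ∑-tight ℓ≤1 (trans cm≡a (sym (∑-1 (a x))))

    module Gap (i : Fin N) (Szi : S (zv i) ≡ true) (L : ℕ) (gap : IsGap S i L) where

      private
        1≤L : 1 ≤ L
        1≤L = proj₁ gap
        L≤N : L ≤ N
        L≤N = proj₁ (proj₂ gap)
        Sz-end : S (zv (shift i L)) ≡ true
        Sz-end = proj₁ (proj₂ (proj₂ gap))
        ¬z-inside : ∀ k → 1 ≤ k → k < L → S (zv (shift i k)) ≡ false
        ¬z-inside = proj₂ (proj₂ (proj₂ gap))

      walk-from : ∀ q → q < L → (ch : (k : ℕ) → Fin (a (shift (shift i q) k))) (lab : ℕ → Bool) →
                  lab 0 ≡ true → Walks.InS (shift i q) ch lab (L ∸ q) → ⊥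
      walk-from q q<L ch lab lab₀ inS =
        Walks.no-walk-to-z (shift i q) ch lab (L ∸ q) (m<n⇒0<n∸m q<L) (≤-trans (m∸n≤m L q) L≤N) lab₀ inS
          (subst (λ x → S (zv x) ≡ true) (trans (cong (shift i) (sym (m∸n+n≡m (<⇒≤ q<L)))) (shift-+ i q (L ∸ q))) Sz-end)

      yf-before-full : ∀ q → q < L → ∀ j → S (yf (shift i q , j)) ≡ true →
                       (∀ k → q < k → k < L → Full (shift i k)) → ⊥
      yf-before-full q q<L j Syf full-after = walk-from q q<L ch lab refl inS
        where
        u = shift i q
        ch : (k : ℕ) → Fin (a (shift u k))
        ch zero = j
        ch (suc k) = edge (shift u (suc k))
        lab : ℕ → Bool
        lab zero = true
        lab (suc k) = false
        inS : Walks.InS u ch lab (L ∸ q)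
        inS zero _ = Syf
        inS (suc k) k<L∸q = edge-ze (shift u (suc k)) (subst Full (shift-+ i q (suc k))
          (full-after (suc k + q) (s≤s (m≤n+m q k)) (subst (suc k + q <_) (m∸n+n≡m (<⇒≤ q<L)) (+-monoˡ-< q k<L∸q))))

      some-not-full : Σ ℕ λ p₀ → p₀ < L × ¬ Full (shift i p₀)
      some-not-full with ¬∀⟶∃¬ L (λ p → Full (shift i (toℕ p))) (λ p → full? _) all-full-impossible
        where
        all-full-impossible : ¬ (∀ (p : Fin L) → Full (shift i (toℕ p)))
        all-full-impossible all-full = walk-from 0 1≤L (λ k → edge (shift i k)) (λ k → label (shift i k))
          (label-at-z i Szi (full 0 1≤L)) (λ k k<L → edge-varL _ (full k k<L))
          where
          full : ∀ k → k < L → Full (shift i k)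
          full k k<L = subst (Full ∘ shift i) (toℕ-fromℕ< k<L) (all-full (Fin.fromℕ< k<L))
      ... | p , ¬full = toℕ p , toℕ<n p , ¬full

      private
        p₀ : ℕ
        p₀ = proj₁ some-not-full
        p₀<L : p₀ < L
        p₀<L = proj₁ (proj₂ some-not-full)
        ¬full₀ : ¬ Full (shift i p₀)
        ¬full₀ = proj₂ (proj₂ some-not-full)

        weight : ℕ → ℕ
        weight p = δ p₀ p + cm (shift i p)

      ∑W≡∑weight : ∑< L (W ∘ shift i) ≡ ∑< L weight
      ∑W≡∑weight = ∑W-gap gap p₀<L

      weight≤Bd : ∀ p → p < L → weight p ≤ Bd (shift i p)
      weight≤Bd p _ with p ≟ p₀
      ... | yes refl = subst (λ k → k + cm (shift i p) ≤ Bd (shift i p)) (sym (δ-diag p₀)) (s≤s (≤-pred (≤∧≢⇒< (cm≤1+a _) ¬full₀)))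
      ... | no p≢p₀ = subst (λ k → k + cm (shift i p) ≤ Bd (shift i p)) (sym (δ-≢ p≢p₀)) (cm≤1+a _)

      gap-≤ : ∑< L (W ∘ shift i) ≤ ∑< L (Bd ∘ shift i)
      gap-≤ = subst (_≤ ∑< L (Bd ∘ shift i)) (sym ∑W≡∑weight) (∑<-mono-≤ L weight≤Bd)

      module Tight (c : ℕ) (c<L : c < L) (full-≢ : ∀ p → p < L → p ≢ c → Full (shift i p)) where

        ¬yf : ∀ j → S (yf (shift i c , j)) ≡ false
        ¬yf j = ¬-not λ Syf → yf-before-full c c<L j Syf λ k c<k k<L → full-≢ k k<L (>⇒≢ c<k)

        after-B : ∀ p → c < p → p < L → TypeB S (shift i p)
        after-B p c<p p<L with full⇒A⊎B _ (full-≢ p p<L (>⇒≢ c<p))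
        ... | inj₂ B = B
        ... | inj₁ (j , c₀ , _) = ⊥-elim (yf-before-full p p<L j (S-at S c₀ kyf)
                λ k p<k k<L → full-≢ k k<L (>⇒≢ (<-trans c<p p<k)))

      tight-form : ∀ c → c < L → cm (shift i c) ≡ a (shift i c) → (∀ p → p < L → p ≢ c → Full (shift i p)) →
                   Form1At S i L ⊎ Form2At S i L
      tight-form zero c<L cm≡a full-≢ = inj₂ ((C , ZT) , after-B)
        where
        open Tight zero c<L full-≢
        ¬yb : ∀ j → S (yb (i , j)) ≡ false
        ¬yb j = ¬-not λ Syb → yb⇒¬z-tail (i , j) Syb Szi
        C : TypeC S i
        C = all-single i cm≡a λ j → length≤1-without-y (admissible _) (∉-contrib S kyf (¬yf j)) (∉-contrib S kyb (¬yb j))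
        ZT : AllZT S i
        ZT j = swap (single-without-y (admissible _) (C j) (∉-contrib S kyf (¬yf j)) (∉-contrib S kyb (¬yb j)))
      tight-form (suc c) c<L cm≡a full-≢ = inj₁ (suc c , s≤s z≤n , c<L , A , mid , (C , Yb) , after-B)
        where
        open Tight (suc c) c<L full-≢
        full₀ : Full i
        full₀ = full-≢ 0 1≤L λ ()
        A : TypeA S i
        A with full⇒A⊎B i full₀
        ... | inj₁ A = A
        ... | inj₂ B = ⊥-elim (z⇒¬B i Szi B)
        mid : ∀ p → 1 ≤ p → p < suc c → TypeA S (shift i p) ⊎ TypeB S (shift i p)
        mid p _ p<c = full⇒A⊎B _ (full-≢ p (<-trans p<c c<L) (<⇒≢ p<c))
        ¬ze : ∀ j → S (ze (shift i (suc c) , j)) ≡ false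
        ¬ze j = ¬-not λ Sze → walk-from 0 1≤L ch lab (label-at-z i Szi full₀) (inS Sze)
          where
          ch : (k : ℕ) → Fin (a (shift i k))
          ch k with k ≟ suc c
          ... | yes refl = j
          ... | no _ = edge (shift i k)
          lab : ℕ → Bool
          lab zero = label i
          lab (suc k) = false
          inS : S (ze (shift i (suc c) , j)) ≡ true → Walks.InS i ch lab L
          inS Sze zero _ = edge-varL i full₀
          inS Sze (suc k) k<L with suc k ≟ suc c
          ... | yes refl = Sze
          ... | no k≢c = edge-ze _ (full-≢ (suc k) k<L k≢c)
        C : TypeC S (shift i (suc c))
        C = all-single _ cm≡a λ j → length≤1-without-z (admissible _) (∉-contrib S kz (¬ze j))
        Yb : AllYbT S (shift i (suc c))
        Yb j = swap (single-without-yf-z (admissible _) (C j) (∉-contrib S kyf (¬yf j)) (∉-contrib S kz (¬ze j)))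

      gap-tight⇒form : ∑< L (W ∘ shift i) ≡ ∑< L (Bd ∘ shift i) → Form1At S i L ⊎ Form2At S i L
      gap-tight⇒form tight = tight-form p₀ p₀<L cm₀ full-≢
        where
        weight≡Bd : ∀ p → p < L → weight p ≡ Bd (shift i p)
        weight≡Bd = ∑<-tight L weight≤Bd (trans (sym ∑W≡∑weight) tight)
        full-≢ : ∀ p → p < L → p ≢ p₀ → Full (shift i p)
        full-≢ p p<L p≢p₀ = trans (cong (_+ cm (shift i p)) (sym (δ-≢ p≢p₀))) (weight≡Bd p p<L)
        cm₀ : cm (shift i p₀) ≡ a (shift i p₀)
        cm₀ = suc-injective (trans (cong (_+ cm (shift i p₀)) (sym (δ-diag p₀))) (weight≡Bd p₀ p₀<L))

    label-or-yb : ∀ x → Full x → label x ≡ true ⊎ S (yb (x , edge x)) ≡ true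
    label-or-yb x full with full? x
    ... | no ¬full = contradiction full ¬full
    ... | yes full' with full⇒A⊎B x full'
    ...   | inj₁ _ = inj₁ refl
    ...   | inj₂ (j , c , _) = inj₂ (S-at S c kyb)

    module Main (card≡ : card S ≡ N + total a) where

      ∑W≡∑Bd : ∑ W ≡ ∑ Bd
      ∑W≡∑Bd = trans (sym card≡∑W) (trans card≡ budget≡∑Bd)

      some-z : Σ (Fin N) λ v → S (zv v) ≡ true
      some-z with any? (λ v → S (zv v) Data.Bool.≟ true)
      ... | yes found = found
      ... | no none = ⊥-elim (all-full-impossible (∑-tight cm≤1+a (trans (sym (trans (∑-distrib-+ (λ x → indicator (S (zv (sucMod x)))) cm) (cong (_+ ∑ cm) no-z))) ∑W≡∑Bd)))
        where
        no-z : ∑ (λ x → indicator (S (zv (sucMod x)))) ≡ 0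
        no-z = trans (∑-cong λ x → cong indicator (¬-not λ Sz → none (sucMod x , Sz))) (∑-0 N)
        all-full-impossible : (∀ x → Full x) → ⊥
        all-full-impossible full with any? (λ x → label x Data.Bool.≟ true)
        ... | yes (x , lab) = Walks.closed-walk-yf x (λ k → edge (shift x k)) (λ k → label (shift x k)) lab
                                (λ k _ → edge-varL _ (full _))
        ... | no no-A = Walks.closed-walk-yb Fin.zero (λ k → edge (shift Fin.zero k))
                          (λ k _ → [ (λ lab → ⊥-elim (no-A (_ , lab))) , (λ Syb → Syb) ]′ (label-or-yb _ (full _)))

      private
        v₀ : Fin N
        v₀ = proj₁ some-z

      open FromMark v₀ (proj₂ some-z)

      gap-tight : ∀ p L → Gap p L → ∑< L (W ∘ shift (shift v₀ p)) ≡ ∑< L (Bd ∘ shift (shift v₀ p))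
      gap-tight p L g = trans (sym (∑<-from W p L)) (trans
        (total-tight⇒gap-tight (W ∘ shift v₀) (Bd ∘ shift v₀) gap-≤′ (proj₂ some-z)
          (trans (sym (∑-rotate W v₀)) (trans ∑W≡∑Bd (∑-rotate Bd v₀))) p L g)
        (∑<-from Bd p L))
        where
        gap-≤′ : ∀ p L → Gap p L → ∑< L (W ∘ shift v₀ ∘ (p +_)) ≤ ∑< L (Bd ∘ shift v₀ ∘ (p +_))
        gap-≤′ p L g = subst₂ _≤_ (sym (∑<-from W p L)) (sym (∑<-from Bd p L))
          (Gap.gap-≤ (shift v₀ p) (proj₁ g) L (gap⇒IsGap p L g))

      gap-form : ∀ i → S (zv i) ≡ true → ∀ L → IsGap S i L → Form1 S (segment i L) ⊎ Form2 S (segment i L)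
      gap-form i Szi L gap = Data.Sum.map (Form1At⇒Form1 S i L) (Form2At⇒Form2 S i L (proj₁ gap)) (Gap.gap-tight⇒form i Szi L gap tight)
        where
        found = shift-surjective v₀ i
        tight : ∑< L (W ∘ shift i) ≡ ∑< L (Bd ∘ shift i)
        tight = subst (λ v → ∑< L (W ∘ shift v) ≡ ∑< L (Bd ∘ shift v)) (proj₂ (proj₂ found))
          (gap-tight (proj₁ found) L (IsGap⇒Gap i Szi L gap (proj₁ found) (proj₁ (proj₂ found)) (proj₂ (proj₂ found))))

-- Sets of the stated shape are facets

module _ {n : ℕ} {a : Fin n → ℕ} (S : Subset n a) where

  one⇒admissible : ∀ {e k k'} → One (contrib S e) k ⊎ One (contrib S e) k' → Admissible (contrib S e)
  one⇒admissible (inj₁ c≡) = subst Admissible (sym c≡) (single _)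
  one⇒admissible (inj₂ c≡) = subst Admissible (sym c≡) (single _)

  absent : ∀ {e k₁ k₂} → One (contrib S e) k₁ ⊎ One (contrib S e) k₂ → ∀ k → k ≢ k₁ → k ≢ k₂ → S (varK e k) ≡ false
  absent {k₁ = k₁} (inj₁ c) k k≢k₁ _ = trans (S-at S c k) (dec-false (k ∈? (k₁ ∷ [])) λ { (here k≡k₁) → k≢k₁ k≡k₁ ; (there ()) })
  absent {k₂ = k₂} (inj₂ c) k _ k≢k₂ = trans (S-at S c k) (dec-false (k ∈? (k₂ ∷ [])) λ { (here k≡k₂) → k≢k₂ k≡k₂ ; (there ()) })

  obligation-swap : ∀ {u v u' v' : Var n a} → Obligation S (u ∷ v ∷ []) (u' ∷ v' ∷ []) → Obligation S (v ∷ u ∷ []) (v' ∷ u' ∷ [])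
  obligation-swap {u} {v} {u'} {v'} (ob₁ , ob₂) =
    (λ lt → ob₁ (<lex-swap {u} {v} {u'} {v'} lt) ∘ contains-swap) , (λ lt → ob₂ (<lex-swap {u'} {v'} {u} {v} lt) ∘ contains-swap)
    where
    deg-swap : ∀ (u v w : Var n a) → deg (v ∷ u ∷ []) w ≡ deg (u ∷ v ∷ []) w
    deg-swap u v w = count-swap (λ x → rank x ==ℕ rank w) v u []
    <lex-swap : ∀ {u v u' v' : Var n a} → (v' ∷ u' ∷ []) <lex (v ∷ u ∷ []) → (u' ∷ v' ∷ []) <lex (u ∷ v ∷ [])
    <lex-swap {u} {v} {u'} {v'} (w , lt , below) = w , subst₂ _<_ (deg-swap u' v' w) (deg-swap u v w) lt ,
      λ w' w'<w → trans (sym (deg-swap u v w')) (trans (below w' w'<w) (deg-swap u' v' w'))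
    contains-swap : ∀ {u v} → Contains S (v ∷ u ∷ []) → Contains S (u ∷ v ∷ [])
    contains-swap (Sv ∷ Su ∷ []) = Su ∷ Sv ∷ []

  data MultiType (x : Fin n) : Set where
    A : TypeA S x → MultiType x
    B : TypeB S x → MultiType x
    C-yb : TypeC S x → AllYbT S x → MultiType x
    C-z : TypeC S x → AllZT S x → MultiType x

  module _ {x : Fin n} where

    admissible-at : MultiType x → ∀ j → Admissible (contrib S (x , j))
    admissible-at (A (j₀ , c₀ , before , after)) j with Fin.<-cmp j j₀
    ... | tri< j<j₀ _ _ = one⇒admissible (before j j<j₀)
    ... | tri≈ _ refl _ = subst Admissible (sym c₀) yf+z
    ... | tri> _ _ j>j₀ = one⇒admissible (after j j>j₀)
    admissible-at (B (j₀ , c₀ , before , after)) j with Fin.<-cmp j j₀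
    ... | tri< j<j₀ _ _ = one⇒admissible (before j j<j₀)
    ... | tri≈ _ refl _ = subst Admissible (sym c₀) yb+z
    ... | tri> _ _ j>j₀ = one⇒admissible (after j j>j₀)
    admissible-at (C-yb _ Yb) j = one⇒admissible (Yb j)
    admissible-at (C-z _ Z) j = one⇒admissible (Z j)

    A-¬yb : TypeA S x → ∀ j → S (yb (x , j)) ≡ false
    A-¬yb (j₀ , c₀ , before , after) j with Fin.<-cmp j j₀
    ... | tri< j<j₀ _ _ = absent (before j j<j₀) kyb (λ ()) (λ ())
    ... | tri≈ _ refl _ = S-at S c₀ kyb
    ... | tri> _ _ j>j₀ = absent (after j j>j₀) kyb (λ ()) (λ ())

    A-yf⇒after : ((j₀ , _) : TypeA S x) → ∀ j → S (yf (x , j)) ≡ true → toℕ j₀ ≤ toℕ j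
    A-yf⇒after (j₀ , c₀ , before , after) j Syf with Fin.<-cmp j j₀
    ... | tri< j<j₀ _ _ = ⊥-elim (not-¬ Syf (absent (before j j<j₀) kyf (λ ()) (λ ())))
    ... | tri≈ _ refl _ = ≤-refl
    ... | tri> _ _ j>j₀ = <⇒≤ j>j₀

    A-ze⇒before : ((j₀ , _) : TypeA S x) → ∀ j → S (ze (x , j)) ≡ true → toℕ j ≤ toℕ j₀
    A-ze⇒before (j₀ , c₀ , before , after) j Sze with Fin.<-cmp j j₀
    ... | tri< j<j₀ _ _ = <⇒≤ j<j₀
    ... | tri≈ _ refl _ = ≤-refl
    ... | tri> _ _ j>j₀ = ⊥-elim (not-¬ Sze (absent (after j j>j₀) kz (λ ()) (λ ())))

    B-¬yf : TypeB S x → ∀ j → S (yf (x , j)) ≡ false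
    B-¬yf (j₀ , c₀ , before , after) j with Fin.<-cmp j j₀
    ... | tri< j<j₀ _ _ = absent (before j j<j₀) kyf (λ ()) (λ ())
    ... | tri≈ _ refl _ = S-at S c₀ kyf
    ... | tri> _ _ j>j₀ = absent (after j j>j₀) kyf (λ ()) (λ ())

    B-yb⇒before : ((j₀ , _) : TypeB S x) → ∀ j → S (yb (x , j)) ≡ true → toℕ j ≤ toℕ j₀
    B-yb⇒before (j₀ , c₀ , before , after) j Syb with Fin.<-cmp j j₀
    ... | tri< j<j₀ _ _ = <⇒≤ j<j₀
    ... | tri≈ _ refl _ = ≤-refl
    ... | tri> _ _ j>j₀ = ⊥-elim (not-¬ Syb (absent (after j j>j₀) kyb (λ ()) (λ ())))

    B-ze⇒after : ((j₀ , _) : TypeB S x) → ∀ j → S (ze (x , j)) ≡ true → toℕ j₀ ≤ toℕ j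
    B-ze⇒after (j₀ , c₀ , before , after) j Sze with Fin.<-cmp j j₀
    ... | tri< j<j₀ _ _ = ⊥-elim (not-¬ Sze (absent (before j j<j₀) kz (λ ()) (λ ())))
    ... | tri≈ _ refl _ = ≤-refl
    ... | tri> _ _ j>j₀ = <⇒≤ j>j₀

    yf⇒A : MultiType x → ∀ j → S (yf (x , j)) ≡ true → TypeA S x
    yf⇒A (A tA) j Syf = tA
    yf⇒A (B tB) j Syf = ⊥-elim (not-¬ Syf (B-¬yf tB j))
    yf⇒A (C-yb _ Yb) j Syf = ⊥-elim (not-¬ Syf (absent (Yb j) kyf (λ ()) (λ ())))
    yf⇒A (C-z _ Z) j Syf = ⊥-elim (not-¬ Syf (absent (Z j) kyf (λ ()) (λ ())))

    ¬yf∧yb : MultiType x → ∀ {j j'} → S (yf (x , j)) ≡ true → S (yb (x , j')) ≡ true → ⊥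
    ¬yf∧yb t {j} {j'} Syf Syb = not-¬ Syb (A-¬yb (yf⇒A t j Syf) j')

    ¬yf∧ze-after : MultiType x → ∀ {j j'} → toℕ j < toℕ j' → S (yf (x , j)) ≡ true → S (ze (x , j')) ≡ true → ⊥
    ¬yf∧ze-after t {j} {j'} j<j' Syf Sze = <-irrefl refl (≤-<-trans (A-yf⇒after tA j Syf) (<-≤-trans j<j' (A-ze⇒before tA j' Sze)))
      where
      tA = yf⇒A t j Syf

    ¬ze∧yb-after : MultiType x → ∀ {j j'} → toℕ j < toℕ j' → S (ze (x , j)) ≡ true → S (yb (x , j')) ≡ true → ⊥
    ¬ze∧yb-after (A tA) j<j' Sze Syb = not-¬ Syb (A-¬yb tA _)
    ¬ze∧yb-after (B tB) {j} {j'} j<j' Sze Syb = <-irrefl refl (≤-<-trans (B-ze⇒after tB j Sze) (<-≤-trans j<j' (B-yb⇒before tB j' Syb)))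
    ¬ze∧yb-after (C-yb _ Yb) {j} j<j' Sze Syb = not-¬ Sze (absent (Yb j) kz (λ ()) (λ ()))
    ¬ze∧yb-after (C-z _ Z) {j' = j'} j<j' Sze Syb = not-¬ Syb (absent (Z j') kyb (λ ()) (λ ()))

module Backward {m : ℕ} (a : Fin (suc (suc (suc m))) → ℕ) (S : Subset (suc (suc (suc m))) a)
                (some-z : Σ (Fin (suc (suc (suc m)))) λ v → S (zv v) ≡ true)
                (forms : ∀ i → S (zv i) ≡ true → ∀ L → IsGap S i L → Form1 S (segment i L) ⊎ Form2 S (segment i L)) where

  N : ℕ
  N = suc (suc (suc m))

  open Ranks {N} {a}
  open Weights S

  private
    v₀ : Fin N
    v₀ = proj₁ some-z

  gap-from : ∀ i → S (zv i) ≡ true → Σ ℕ (IsGap S i)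
  gap-from i Szi with first-true-below (λ k → S (zv (shift i k))) N (s≤s z≤n)
                        (subst (λ v → S (zv v) ≡ true) (sym (shift-period i)) Szi)
  ... | L , L≤N , 1≤L , SzL , ¬z = L , 1≤L , L≤N , SzL , ¬z

  form-at : ∀ i → S (zv i) ≡ true → ∀ L → IsGap S i L → Form1At S i L ⊎ Form2At S i L
  form-at i Szi L gap = [ inj₁ ∘ Form1⇒Form1At S i L , inj₂ ∘ Form2⇒Form2At S i L ]′ (forms i Szi L gap)

  record Location (x : Fin N) : Set where
    field
      start : Fin N
      len offset : ℕ
      z-start : S (zv start) ≡ true
      gap : IsGap S start len
      offset<len : offset < len
      at : shift start offset ≡ x

  locate : ∀ x → Location x
  locate x with shift-surjective v₀ x
  ... | q , _ , v₀+q≡x with last-true (λ k → S (zv (shift v₀ k))) (proj₂ some-z) q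
  ...   | p , p≤q , Zp , ¬Z-after with gap-from (shift v₀ p) Zp
  ...     | L , gap = record { start = shift v₀ p ; len = L ; offset = q ∸ p ; z-start = Zp ; gap = gap
                             ; offset<len = q∸p<L ; at = trans (sym (shift-+ v₀ p (q ∸ p))) (trans (cong (shift v₀) (m∸n+n≡m p≤q)) v₀+q≡x) }
    where
    q∸p<L : q ∸ p < L
    q∸p<L with q ∸ p <? L
    ... | yes q∸p<L = q∸p<L
    ... | no q∸p≮L = ⊥-elim (not-¬ (subst (λ v → S (zv v) ≡ true) (sym (trans (cong (shift v₀) (+-comm p L)) (shift-+ v₀ p L))) (proj₁ (proj₂ (proj₂ gap))))
                       (¬Z-after (p + L) (m<m+n p (proj₁ gap)) (subst (p + L ≤_) (m+[n∸m]≡n p≤q) (+-monoʳ-≤ p (≮⇒≥ q∸p≮L)))))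

  type-in-gap : ∀ i L → Form1At S i L ⊎ Form2At S i L → ∀ p → p < L → MultiType S (shift i p)
  type-in-gap i L (inj₁ (c , _ , _ , tA , mid , (C , Yb) , after)) zero _ = A tA
  type-in-gap i L (inj₁ (c , _ , _ , tA , mid , (C , Yb) , after)) (suc p) p<L with <-cmp (suc p) c
  ... | tri< p<c _ _ = [ A , B ]′ (mid (suc p) (s≤s z≤n) p<c)
  ... | tri≈ _ refl _ = C-yb C Yb
  ... | tri> _ _ p>c = B (after (suc p) p>c p<L)
  type-in-gap i L (inj₂ ((C , Z) , after)) zero _ = C-z C Z
  type-in-gap i L (inj₂ (_ , after)) (suc p) p<L = B (after (suc p) (s≤s z≤n) p<L)

  type-at : ∀ x → MultiType S x
  type-at x = subst (MultiType S) at (type-in-gap start len (form-at start z-start len gap) offset offset<len)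
    where open Location (locate x)

  Active : Fin N → Set
  Active y = Σ (Fin (a y)) λ j → S (yf (y , j)) ≡ true ⊎ S (ze (y , j)) ≡ true

  C-yb-inactive : ∀ {y} → AllYbT S y → ¬ Active y
  C-yb-inactive Yb (j , inj₁ Syf) = not-¬ Syf (absent S (Yb j) kyf (λ ()) (λ ()))
  C-yb-inactive Yb (j , inj₂ Sze) = not-¬ Sze (absent S (Yb j) kz (λ ()) (λ ()))

  -- x lies in a gap of form (1) strictly before its type C multi-edge
  record Ascending (x : Fin N) : Set where
    field
      start : Fin N
      len : ℕ
      gap : IsGap S start len
      form : Form1At S start len
      offset : ℕ
      offset<c : offset < proj₁ form
      at : shift start offset ≡ x

  module _ {x : Fin N} (asc : Ascending x) where
    open Ascending asc

    private
      c = proj₁ form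
      c<len : c < len
      c<len = proj₁ (proj₂ (proj₂ form))
      Yb-at-c : AllYbT S (shift start c)
      Yb-at-c = proj₂ (proj₁ (proj₂ (proj₂ (proj₂ (proj₂ (proj₂ form))))))

    ascending⇒¬z-next : S (zv (sucMod x)) ≡ false
    ascending⇒¬z-next = subst (λ v → S (zv v) ≡ false) (cong sucMod at)
      (proj₂ (proj₂ (proj₂ gap)) (suc offset) (s≤s z≤n) (≤-<-trans offset<c c<len))

    ascending-step : Active (sucMod x) → Ascending (sucMod x)
    ascending-step act with m≤n⇒m<n∨m≡n offset<c
    ... | inj₁ offset+1<c = record { start = start ; len = len ; gap = gap ; form = form ; offset = suc offset
                                   ; offset<c = offset+1<c ; at = cong sucMod at }
    ... | inj₂ offset+1≡c = ⊥-elim (C-yb-inactive Yb-at-c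
            (subst Active (trans (cong sucMod (sym at)) (cong (shift start) offset+1≡c)) act))

    ascending⇒inactive : Σ (Fin N) λ y → ¬ Active y
    ascending⇒inactive = shift start c , C-yb-inactive Yb-at-c

  classify : ∀ i L → IsGap S i L → Form1At S i L ⊎ Form2At S i L → ∀ p → p < L →
             Ascending (shift i p) ⊎ (∀ j → S (yf (shift i p , j)) ≡ false)
  classify i L gap (inj₁ form@(c , _ , _ , _ , _ , (_ , Yb) , after)) p p<L with <-cmp p c
  ... | tri< p<c _ _ = inj₁ (record { start = i ; len = L ; gap = gap ; form = form ; offset = p ; offset<c = p<c ; at = refl })
  ... | tri≈ _ refl _ = inj₂ λ j → absent S (Yb j) kyf (λ ()) (λ ())
  ... | tri> _ _ p>c = inj₂ (B-¬yf S (after p p>c p<L))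
  classify i L gap (inj₂ ((_ , Z) , after)) zero p<L = inj₂ λ j → absent S (Z j) kyf (λ ()) (λ ())
  classify i L gap (inj₂ ((_ , Z) , after)) (suc p) p<L = inj₂ (B-¬yf S (after (suc p) (s≤s z≤n) p<L))

  yf⇒ascending : ∀ x j → S (yf (x , j)) ≡ true → Ascending x
  yf⇒ascending x j Syf with locate x
  ... | record { start = i ; len = L ; offset = p ; z-start = Szi ; gap = gap ; offset<len = p<L ; at = refl } =
    [ (λ asc → asc) , (λ ¬yf → ⊥-elim (not-¬ Syf (¬yf j))) ]′ (classify i L gap (form-at i Szi L gap) p p<L)

  yb⇒¬z : ∀ x j → S (yb (x , j)) ≡ true → S (zv x) ≡ false
  yb⇒¬z x j Syb with locate x
  ... | record { start = i ; len = L ; offset = suc p ; gap = gap ; offset<len = p<L ; at = refl } =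
    proj₂ (proj₂ (proj₂ gap)) (suc p) (s≤s z≤n) p<L
  ... | record { start = i ; len = L ; offset = zero ; z-start = Szi ; gap = gap ; at = refl } =
    ⊥-elim (not-¬ Syb ([ (λ { (_ , _ , _ , tA , _) → A-¬yb S tA j }) , (λ { ((_ , Z) , _) → absent S (Z j) kyb (λ ()) (λ ()) }) ]′ (form-at i Szi L gap)))

  private
    St = Step N a

  active-fwd : ∀ (pb : St × Bool) → dir (proj₁ pb) ≡ fwd → S (varL pb) ≡ true → Active (mult (proj₁ pb))
  active-fwd ((( _ , j) , fwd) , true) _ S-yf = j , inj₁ S-yf
  active-fwd (((_ , j) , fwd) , false) _ S-ze = j , inj₂ S-ze

  active-bwd : ∀ (pb : St × Bool) → dir (proj₁ pb) ≡ bwd → S (varR pb) ≡ true → Active (mult (proj₁ pb))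
  active-bwd (((_ , j) , bwd) , true) _ S-ze = j , inj₂ S-ze
  active-bwd (((_ , j) , bwd) , false) _ S-yf = j , inj₁ S-yf

  ascending-fwd : ∀ (t : St) ts → Chain (t ∷ ts) → All (λ s → dir s ≡ fwd) (t ∷ ts) → All (Active ∘ mult) ts →
                  Ascending (mult t) → All (Ascending ∘ mult) (t ∷ ts)
  ascending-fwd t [] _ _ _ asc = asc ∷ []
  ascending-fwd ((_ , _) , fwd) (t'@((_ , _) , fwd) ∷ ts) (refl , chain) (_ ∷ fwds) (act ∷ acts) asc =
    asc ∷ ascending-fwd t' ts chain fwds acts (ascending-step asc act)
  ascending-fwd ((_ , _) , fwd) (((_ , _) , bwd) ∷ ts) _ (_ ∷ () ∷ _) _ _
  ascending-fwd ((_ , _) , bwd) _ _ (() ∷ _) _ _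

  ascending-bwd : ∀ (t : St) ts → Chain (t ∷ ts) → All (λ s → dir s ≡ bwd) (t ∷ ts) → All (Active ∘ mult) (t ∷ ts) →
                  Any (Ascending ∘ mult) (t ∷ ts) → Ascending (mult t)
  ascending-bwd t ts _ _ _ (here asc) = asc
  ascending-bwd ((_ , _) , bwd) (t'@((_ , _) , bwd) ∷ ts) (refl , chain) (_ ∷ bwds) (act ∷ acts) (there any) =
    ascending-step (ascending-bwd t' ts chain bwds acts any) act
  ascending-bwd ((_ , _) , bwd) (((_ , _) , fwd) ∷ ts) _ (_ ∷ () ∷ _) _ _
  ascending-bwd ((_ , _) , fwd) _ _ (() ∷ _) _ _

  no-clash : ∀ e → NoClash S e
  no-clash (x , j) = admissible⇒noClash S (admissible-at S (type-at x) j)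

  covering-active : ∀ {ss : List St} → Covers ss → All (Active ∘ mult) ss → ∀ {x} → Ascending x → ⊥
  covering-active cover acts asc with ascending⇒inactive asc
  ... | y , ¬act with cover y
  ...   | s , s∈ , refl = ¬act (All.lookup acts s∈)

  covering-yb : ∀ {ss : List St} → Covers ss → All (λ s → S (yb (edgeOf s)) ≡ true) ss → ⊥
  covering-yb cover ybs with cover v₀
  ... | s , s∈ , refl = not-¬ (proj₂ some-z) (yb⇒¬z _ _ (All.lookup ybs s∈))

  two-cycle : ∀ x {j j' : Fin (a x)} → j ≢ j' → ∀ b b' →
    Obligation S (monoL ((((x , j) , fwd) , b) ∷ (((x , j') , bwd) , b') ∷ []))
                 (monoR ((((x , j) , fwd) , b) ∷ (((x , j') , bwd) , b') ∷ []))
  two-cycle x {j} {j'} j≢j' true true = obligation-leadˡ S (yf (x , j)) (here refl)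
    (yf<ze (x , j) (x , j) ∷ yf<ze (x , j) (x , j') ∷ []) λ { (Syf ∷ Syb ∷ []) → ¬yf∧yb S (type-at x) Syf Syb }
  two-cycle x {j} {j'} j≢j' false false = obligation-leadʳ S (yf (x , j')) (there (here refl))
    (yf<ze (x , j') (x , j) ∷ yf<ze (x , j') (x , j') ∷ []) λ { (Syb ∷ Syf ∷ []) → ¬yf∧yb S (type-at x) Syf Syb }
  two-cycle x {j} {j'} j≢j' true false with Fin.<-cmp j j'
  ... | tri< j<j' _ _ = obligation-leadˡ S (yf (x , j)) (here refl)
    (yf<ze (x , j) (x , j) ∷ yf-mono x j<j' ∷ []) λ { (Syf ∷ Sze ∷ []) → ¬yf∧ze-after S (type-at x) j<j' Syf Sze }
  ... | tri≈ _ j≡j' _ = contradiction j≡j' j≢j'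
  ... | tri> _ _ j'<j = obligation-leadʳ S (yf (x , j')) (there (here refl))
    (yf-mono x j'<j ∷ yf<ze (x , j') (x , j') ∷ []) λ { (Sze ∷ Syf ∷ []) → ¬yf∧ze-after S (type-at x) j'<j Syf Sze }
  two-cycle x {j} {j'} j≢j' false true with Fin.<-cmp j j'
  ... | tri< j<j' _ _ = obligation-leadˡ S (yb (x , j')) (there (here refl))
    (yb-anti x j<j' ∷ yb<ze (x , j') (x , j') ∷ []) λ { (Sze ∷ Syb ∷ []) → ¬ze∧yb-after S (type-at x) j<j' Sze Syb }
  ... | tri≈ _ j≡j' _ = contradiction j≡j' j≢j'
  ... | tri> _ _ j'<j = obligation-leadʳ S (yb (x , j)) (here refl)
    (yb<ze (x , j) (x , j) ∷ yb-anti x j'<j ∷ []) λ { (Syb ∷ Sze ∷ []) → ¬ze∧yb-after S (type-at x) j'<j Sze Syb }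

  two-step-cycle : ∀ (p₁ p₂ : St × Bool) → Chain (proj₁ p₁ ∷ proj₁ p₂ ∷ proj₁ p₁ ∷ []) →
                   Unique (map edgeOf (proj₁ p₁ ∷ proj₁ p₂ ∷ [])) → Obligation S (monoL (p₁ ∷ p₂ ∷ [])) (monoR (p₁ ∷ p₂ ∷ []))
  two-step-cycle (((x , j) , fwd) , b) (((x' , j') , fwd) , b') (refl , back , _) _ =
    ⊥-elim (0≢1+n (shift-injective x (s≤s z≤n) (s≤s (s≤s (s≤s z≤n))) (sym back)))
  two-step-cycle (((x , j) , bwd) , b) (((x' , j') , bwd) , b') (refl , back , _) _ =
    ⊥-elim (0≢1+n (shift-injective x' (s≤s z≤n) (s≤s (s≤s (s≤s z≤n))) back))
  two-step-cycle (((x , j) , fwd) , b) (((x' , j') , bwd) , b') (linked , _) ((e≢e' ∷ []) ∷ _) with sucMod-injective {x = x} {x'} linked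
  ... | refl = two-cycle x {j} {j'} (λ j≡j' → e≢e' (cong (x ,_) j≡j')) b b'
  two-step-cycle (((x , j) , bwd) , b) (((x' , j') , fwd) , b') (refl , _) ((e≢e' ∷ []) ∷ _) =
    obligation-swap S (two-cycle x {j'} {j} (λ j'≡j → e≢e' (cong (x ,_) (sym j'≡j))) b' b)

  private
    varL-fwd-true : ∀ (pb : St × Bool) → dir (proj₁ pb) ≡ fwd → proj₂ pb ≡ true → varL pb ≡ yf (edgeOf (proj₁ pb))
    varL-fwd-true ((_ , fwd) , true) _ _ = refl
    varL-fwd-false : ∀ (pb : St × Bool) → dir (proj₁ pb) ≡ fwd → proj₂ pb ≡ false → varL pb ≡ ze (edgeOf (proj₁ pb))
    varL-fwd-false ((_ , fwd) , false) _ _ = refl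
    varR-fwd-false : ∀ (pb : St × Bool) → dir (proj₁ pb) ≡ fwd → proj₂ pb ≡ false → varR pb ≡ yb (edgeOf (proj₁ pb))
    varR-fwd-false ((_ , fwd) , false) _ _ = refl
    varR-bwd-false : ∀ (pb : St × Bool) → dir (proj₁ pb) ≡ bwd → proj₂ pb ≡ false → varR pb ≡ yf (edgeOf (proj₁ pb))
    varR-bwd-false ((_ , bwd) , false) _ _ = refl
    varR-bwd-true : ∀ (pb : St × Bool) → dir (proj₁ pb) ≡ bwd → proj₂ pb ≡ true → varR pb ≡ ze (edgeOf (proj₁ pb))
    varR-bwd-true ((_ , bwd) , true) _ _ = refl
    varL-bwd-true : ∀ (pb : St × Bool) → dir (proj₁ pb) ≡ bwd → proj₂ pb ≡ true → varL pb ≡ yb (edgeOf (proj₁ pb))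
    varL-bwd-true ((_ , bwd) , true) _ _ = refl

  zigzag-obligation : ∀ (s₁ : St) mid (s₂ : St) → let ps = (s₁ , true) ∷ mid ++ (s₂ , false) ∷ [] in
    Chain (map proj₁ ps) → Unique (tailS s₁ ∷ map headS (map proj₁ ps)) →
    Obligation S (zv (headS s₂) ∷ monoL ps) (zv (tailS s₁) ∷ monoR ps)
  zigzag-obligation s₁ mid s₂ chain unique = by-direction (dir s₁) refl
    where
    ps = (s₁ , true) ∷ mid ++ (s₂ , false) ∷ []
    steps-dir : All (λ s → dir s ≡ dir s₁) (map proj₁ ps)
    steps-dir = path-direction s₁ _ chain unique
    dirs : All (λ pb → dir (proj₁ pb) ≡ dir s₁) ps
    dirs = All.map⁻ steps-dir
    s₂∈ : (s₂ , false) ∈ ps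
    s₂∈ = there (∈-++⁺ʳ mid (here refl))

    by-direction : ∀ d → dir s₁ ≡ d → Obligation S (zv (headS s₂) ∷ monoL ps) (zv (tailS s₁) ∷ monoR ps)
    by-direction fwd d₁ = obligation-leadˡ S (yf (edgeOf s₁)) (there (here (sym (varL-fwd-true (s₁ , true) d₁ refl))))
      (yf<zv (edgeOf s₁) (tailS s₁) ∷ All.map⁺ (All.map (λ {pb} d → yf<rank (edgeOf s₁) (varR pb) (big-varR-fwd pb (trans d d₁))) dirs))
      λ { (Sz ∷ inS) → not-¬ Sz (¬z-at-head (All.map⁻ inS)) }
      where
      ¬z-at-head : All (λ pb → S (varL pb) ≡ true) ps → S (zv (headS s₂)) ≡ false
      ¬z-at-head inS = subst (λ v → S (zv v) ≡ false) (head≡ s₂ (trans (All.lookup dirs s₂∈) d₁)) (ascending⇒¬z-next asc₂)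
        where
        acts : All (Active ∘ mult) (map proj₁ ps)
        acts = All.map⁺ (All.zipWith (λ (d , h) → active-fwd _ (trans d d₁) h) (dirs , inS))
        asc₁ : Ascending (mult s₁)
        asc₁ = yf⇒ascending _ _ (subst (λ v → S v ≡ true) (varL-fwd-true (s₁ , true) d₁ refl) (All.head inS))
        asc₂ : Ascending (mult s₂)
        asc₂ = All.lookup (ascending-fwd s₁ _ chain (All.map (λ d → trans d d₁) steps-dir) (All.tail acts) asc₁) (∈-map⁺ proj₁ s₂∈)
        head≡ : ∀ (s : St) → dir s ≡ fwd → sucMod (mult s) ≡ headS s
        head≡ ((_ , _) , fwd) _ = refl
    by-direction bwd d₁ = obligation-leadʳ S (yf (edgeOf s₂)) (there yf₂∈)
      (yf<zv (edgeOf s₂) (headS s₂) ∷ All.map⁺ (All.map (λ {pb} d → yf<rank (edgeOf s₂) (varL pb) (big-varL-bwd pb (trans d d₁))) dirs))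
      λ { (Sz ∷ inS) → not-¬ Sz (¬z-at-tail (All.map⁻ inS)) }
      where
      d₂ : dir s₂ ≡ bwd
      d₂ = trans (All.lookup dirs s₂∈) d₁
      yf₂∈ : yf (edgeOf s₂) ∈ monoR ps
      yf₂∈ = subst (_∈ monoR ps) (varR-bwd-false (s₂ , false) d₂ refl) (∈-map⁺ varR s₂∈)
      ¬z-at-tail : All (λ pb → S (varR pb) ≡ true) ps → S (zv (tailS s₁)) ≡ false
      ¬z-at-tail inS = subst (λ v → S (zv v) ≡ false) (tail≡ s₁ d₁) (ascending⇒¬z-next asc₁)
        where
        acts : All (Active ∘ mult) (map proj₁ ps)
        acts = All.map⁺ (All.zipWith (λ (d , h) → active-bwd _ (trans d d₁) h) (dirs , inS))
        asc₂ : Ascending (mult s₂)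
        asc₂ = yf⇒ascending _ _ (subst (λ v → S v ≡ true) (varR-bwd-false (s₂ , false) d₂ refl) (All.lookup inS s₂∈))
        asc₁ : Ascending (mult s₁)
        asc₁ = ascending-bwd s₁ _ chain (All.map (λ d → trans d d₁) steps-dir) acts (lose (∈-map⁺ proj₁ s₂∈) asc₂)
        tail≡ : ∀ (s : St) → dir s ≡ bwd → sucMod (mult s) ≡ tailS s
        tail≡ ((_ , _) , bwd) _ = refl

  cycle-obligation : ∀ (p₁ p₂ p₃ : St × Bool) rest → let ps = p₁ ∷ p₂ ∷ p₃ ∷ rest in
    Chain (map proj₁ ps ++ proj₁ p₁ ∷ []) → Unique (map tailS (map proj₁ ps)) → Obligation S (monoL ps) (monoR ps)
  cycle-obligation p₁ p₂ p₃ rest chain unique = by-direction (dir s₁) refl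
    where
    ps = p₁ ∷ p₂ ∷ p₃ ∷ rest
    s₁ = proj₁ p₁
    e₁ = edgeOf s₁
    steps-dir : All (λ s → dir s ≡ dir s₁) (map proj₁ ps)
    steps-dir = cycle-direction s₁ (proj₁ p₂) (proj₁ p₃) (map proj₁ rest) chain unique
    dirs : All (λ pb → dir (proj₁ pb) ≡ dir s₁) ps
    dirs = All.map⁻ steps-dir
    labels-false : ¬ Any (λ pb → proj₂ pb ≡ true) ps → All (λ pb → proj₂ pb ≡ false) ps
    labels-false none = All.map ¬-not (All.¬Any⇒All¬ ps none)
    labels-true : ¬ Any (λ pb → proj₂ pb ≡ false) ps → All (λ pb → proj₂ pb ≡ true) ps
    labels-true none = All.map ¬-not (All.¬Any⇒All¬ ps none)

    by-direction : ∀ d → dir s₁ ≡ d → Obligation S (monoL ps) (monoR ps)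
    by-direction fwd d₁ with Any.any? (λ pb → proj₂ pb Data.Bool.≟ true) ps
    ... | yes some-true = obligation-leadˡ S (yf (edgeOf (proj₁ pb))) yf∈
          (All.map⁺ (All.map (λ {pb'} d → yf<rank (edgeOf (proj₁ pb)) (varR pb') (big-varR-fwd pb' (trans d d₁))) dirs))
          λ inS → covering-active cover (acts (All.map⁻ inS))
                    (yf⇒ascending _ _ (subst (λ v → S v ≡ true) yf≡ (All.lookup (All.map⁻ inS) pb∈)))
      where
      cover = covers-fwd (map proj₁ ps) s₁ (here refl) chain (All.map (λ d → trans d d₁) steps-dir)
      pb = proj₁ (find some-true)
      pb∈ = proj₁ (proj₂ (find some-true))
      yf≡ : varL pb ≡ yf (edgeOf (proj₁ pb))
      yf≡ = varL-fwd-true pb (trans (All.lookup dirs pb∈) d₁) (proj₂ (proj₂ (find some-true)))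
      yf∈ : yf (edgeOf (proj₁ pb)) ∈ monoL ps
      yf∈ = subst (_∈ monoL ps) yf≡ (∈-map⁺ varL pb∈)
      acts : All (λ pb → S (varL pb) ≡ true) ps → All (Active ∘ mult) (map proj₁ ps)
      acts inS = All.map⁺ (All.zipWith (λ (d , h) → active-fwd _ (trans d d₁) h) (dirs , inS))
    ... | no no-true = obligation-leadʳ S (yb e₁) (here (sym (varR-fwd-false p₁ d₁ (All.head falses))))
          (All.map⁺ (All.zipWith (λ {pb} (d , f) → subst (λ v → rank (yb e₁) < rank v) (sym (varL-fwd-false pb (trans d d₁) f))
                                                       (yb<ze e₁ (edgeOf (proj₁ pb)))) (dirs , falses)))
          λ inS → covering-yb cover (All.map⁺ (All.zipWith (λ {pb} ((d , f) , h) → subst (λ v → S v ≡ true) (varR-fwd-false pb (trans d d₁) f) h)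
                                                             (All.zipWith (λ x → x) (dirs , falses) , All.map⁻ inS)))
      where
      cover = covers-fwd (map proj₁ ps) s₁ (here refl) chain (All.map (λ d → trans d d₁) steps-dir)
      falses = labels-false no-true
    by-direction bwd d₁ with Any.any? (λ pb → proj₂ pb Data.Bool.≟ false) ps
    ... | yes some-false = obligation-leadʳ S (yf (edgeOf (proj₁ pb))) yf∈
          (All.map⁺ (All.map (λ {pb'} d → yf<rank (edgeOf (proj₁ pb)) (varL pb') (big-varL-bwd pb' (trans d d₁))) dirs))
          λ inS → covering-active cover (acts (All.map⁻ inS))
                    (yf⇒ascending _ _ (subst (λ v → S v ≡ true) yf≡ (All.lookup (All.map⁻ inS) pb∈)))
      where
      cover = covers-bwd (map proj₁ ps) s₁ (here refl) chain (All.map (λ d → trans d d₁) steps-dir)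
      pb = proj₁ (find some-false)
      pb∈ = proj₁ (proj₂ (find some-false))
      yf≡ : varR pb ≡ yf (edgeOf (proj₁ pb))
      yf≡ = varR-bwd-false pb (trans (All.lookup dirs pb∈) d₁) (proj₂ (proj₂ (find some-false)))
      yf∈ : yf (edgeOf (proj₁ pb)) ∈ monoR ps
      yf∈ = subst (_∈ monoR ps) yf≡ (∈-map⁺ varR pb∈)
      acts : All (λ pb → S (varR pb) ≡ true) ps → All (Active ∘ mult) (map proj₁ ps)
      acts inS = All.map⁺ (All.zipWith (λ (d , h) → active-bwd _ (trans d d₁) h) (dirs , inS))
    ... | no no-false = obligation-leadˡ S (yb e₁) (here (sym (varL-bwd-true p₁ d₁ (All.head trues))))
          (All.map⁺ (All.zipWith (λ {pb} (d , t) → subst (λ v → rank (yb e₁) < rank v) (sym (varR-bwd-true pb (trans d d₁) t))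
                                                       (yb<ze e₁ (edgeOf (proj₁ pb)))) (dirs , trues)))
          λ inS → covering-yb cover (All.map⁺ (All.zipWith (λ {pb} ((d , t) , h) → subst (λ v → S v ≡ true) (varL-bwd-true pb (trans d d₁) t) h)
                                                             (All.zipWith (λ x → x) (dirs , trues) , All.map⁻ inS)))
      where
      cover = covers-bwd (map proj₁ ps) s₁ (here refl) chain (All.map (λ d → trans d d₁) steps-dir)
      trues = labels-true no-false

  avoids : AvoidsLeading S
  avoids _ _ (fund1 e) = obligation-leadˡ S (yf e) (here refl) (yf<ze e e ∷ yf<ze e e ∷ [])
    λ { (Syf ∷ Syb ∷ []) → no-clash e yf-yb Syf Syb }
  avoids _ _ (fund2 e) = obligation-leadˡ S (yf e) (here refl) (yf<zv e _ ∷ yf<zv e _ ∷ [])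
    λ { (Syf ∷ St ∷ []) → no-clash e yf-t Syf St }
  avoids _ _ (fund3 e) = obligation-leadˡ S (yb e) (here refl) (yb<zv e _ ∷ yb<zv e _ ∷ [])
    λ { (Syb ∷ St ∷ []) → no-clash e yb-t Syb St }
  avoids _ _ (fund4 e) = obligation-leadˡ S (yf e) (here refl) (yf<zv e _ ∷ yf<ze e e ∷ [])
    λ { (Syf ∷ Sz ∷ []) → not-¬ Sz (ascending⇒¬z-next (yf⇒ascending _ _ Syf)) }
  avoids _ _ (fund5 e) = obligation-leadˡ S (yb e) (here refl) (yb<zv e _ ∷ yb<ze e e ∷ [])
    λ { (Syb ∷ Sz ∷ []) → not-¬ Sz (yb⇒¬z _ _ Syb) }
  avoids _ _ (fund6 e) = obligation-leadˡ S (ze e) (there (here refl)) (ze<zv e _ ∷ ze<zv e _ ∷ [])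
    λ { (St ∷ Sze ∷ []) → no-clash e t-z St Sze }
  avoids _ _ (zigzag s₁ mid s₂ chain unique) = zigzag-obligation s₁ mid s₂ chain unique
  avoids _ _ (cyclic p₁ p₂ [] chain _ edges) = two-step-cycle p₁ p₂ chain edges
  avoids _ _ (cyclic p₁ p₂ (p₃ ∷ rest) chain tails _) = cycle-obligation p₁ p₂ p₃ rest chain tails

  cm-doubled : ∀ {x} (j₀ : Fin (a x)) → ℓ (x , j₀) ≡ 2 →
               (∀ j → j Fin.< j₀ → ℓ (x , j) ≡ 1) → (∀ j → j₀ Fin.< j → ℓ (x , j) ≡ 1) → cm x ≡ suc (a x)
  cm-doubled {x} j₀ ℓ₀≡2 before after = trans (∑-cong at) (∑-1+δ j₀)
    where
    at : ∀ j → ℓ (x , j) ≡ suc (δ (toℕ j₀) (toℕ j))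
    at j with Fin.<-cmp j j₀
    ... | tri< j<j₀ _ _ = trans (before j j<j₀) (cong suc (sym (δ-≢ (<⇒≢ j<j₀))))
    ... | tri≈ _ refl _ = trans ℓ₀≡2 (cong suc (sym (δ-diag (toℕ j₀))))
    ... | tri> _ _ j>j₀ = trans (after j j>j₀) (cong suc (sym (δ-≢ (>⇒≢ j>j₀))))

  single-length : ∀ {e k k'} → One (contrib S e) k ⊎ One (contrib S e) k' → length (contrib S e) ≡ 1
  single-length (inj₁ c≡) = cong length c≡
  single-length (inj₂ c≡) = cong length c≡

  cm-A : ∀ {x} → TypeA S x → cm x ≡ suc (a x)
  cm-A (j₀ , c₀ , before , after) = cm-doubled j₀ (cong length c₀) (λ j lt → single-length (before j lt)) (λ j gt → single-length (after j gt))

  cm-B : ∀ {x} → TypeB S x → cm x ≡ suc (a x)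
  cm-B (j₀ , c₀ , before , after) = cm-doubled j₀ (cong length c₀) (λ j lt → single-length (before j lt)) (λ j gt → single-length (after j gt))

  cm-C : ∀ {x} → TypeC S x → cm x ≡ a x
  cm-C {x} C = trans (∑-cong C) (∑-1 (a x))

  gap-tight : ∀ i → S (zv i) ≡ true → ∀ L → IsGap S i L → ∑< L (W ∘ shift i) ≡ ∑< L (Bd ∘ shift i)
  gap-tight i Szi L gap = tight (form-at i Szi L gap)
    where
    tight : Form1At S i L ⊎ Form2At S i L → ∑< L (W ∘ shift i) ≡ ∑< L (Bd ∘ shift i)
    tight (inj₁ (c , _ , c<L , tA , mid , (C , _) , after)) = trans (∑W-gap gap c<L) (∑<-cong L at)
      where
      at : ∀ p → p < L → δ c p + cm (shift i p) ≡ Bd (shift i p)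
      at p p<L with <-cmp p c
      ... | tri≈ _ refl _ = cong₂ _+_ (δ-diag c) (cm-C C)
      ... | tri> _ _ p>c = trans (cong (_+ _) (δ-≢ (>⇒≢ p>c))) (cm-B (after p p>c p<L))
      at zero p<L | tri< p<c _ _ = trans (cong (_+ _) (δ-≢ (<⇒≢ p<c))) (cm-A tA)
      at (suc p) p<L | tri< p<c _ _ = trans (cong (_+ _) (δ-≢ (<⇒≢ p<c))) ([ cm-A , cm-B ]′ (mid (suc p) (s≤s z≤n) p<c))
    tight (inj₂ ((C , _) , after)) = trans (∑W-gap gap (proj₁ gap)) (∑<-cong L at)
      where
      at : ∀ p → p < L → δ 0 p + cm (shift i p) ≡ Bd (shift i p)
      at zero _ = cong suc (cm-C C)
      at (suc p) p<L = cm-B (after (suc p) (s≤s z≤n) p<L)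

  card≡ : card S ≡ N + total a
  card≡ = begin
    card S                          ≡⟨ card≡∑W ⟩
    ∑ W                             ≡⟨ ∑-rotate W v₀ ⟩
    ∑< N (W ∘ shift v₀)             ≡⟨ ≤-antisym (total-≤ (W ∘ shift v₀) (Bd ∘ shift v₀) (λ p L g → ≤-reflexive (gap-tight′ p L g)) (proj₂ some-z))
                                                 (total-≤ (Bd ∘ shift v₀) (W ∘ shift v₀) (λ p L g → ≤-reflexive (sym (gap-tight′ p L g))) (proj₂ some-z)) ⟩
    ∑< N (Bd ∘ shift v₀)            ≡⟨ ∑-rotate Bd v₀ ⟨
    ∑ Bd                            ≡⟨ budget≡∑Bd ⟨
    N + total a                     ∎
    where
    open ≡-Reasoning
    open FromMark v₀ (proj₂ some-z)
    gap-tight′ : ∀ p L → Gap p L → ∑< L (W ∘ shift v₀ ∘ (p +_)) ≡ ∑< L (Bd ∘ shift v₀ ∘ (p +_))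
    gap-tight′ p L g = trans (∑<-from W p L) (trans (gap-tight (shift v₀ p) (proj₁ g) L (gap⇒IsGap p L g)) (sym (∑<-from Bd p L)))

theorem4p2 : (n : ℕ) → 3 ≤ n → (a : Fin n → ℕ) → (∀ i → 1 ≤ a i) →
    (S : Subset n a) →
    IsFacet n a S ⇔
      ((Σ (Fin n) λ i → S (zv i) ≡ true) ×
       (∀ i → S (zv i) ≡ true → ∀ L → IsGap S i L →
          Form1 S (segment i L) ⊎ Form2 S (segment i L)))
theorem4p2 (suc (suc (suc m))) (s≤s (s≤s (s≤s _))) a 1≤a S = mk⇔
  (λ (card≡ , avoids) → let open Forward.Gaps.Main a S avoids 1≤a card≡ in some-z , gap-form)
  (λ (some-z , forms) → let open Backward a S some-z forms in card≡ , avoids)
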